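{- Let $n\ge 2$, let $s,t$ be nonnegative integers with $s+t\le n$, and $N=n+2s+t$. Then $$n_{3,3}(s,t,n)=\binom{N-1}{s} f_{(n-2,s+t)}.$$
   Context: A continuous multiline queue of type $(s,t,n-s-t)$ is a three-row array whose rows are strictly increasing sequences $a_1<\cdots<a_s$, $b_1<\cdots<b_{s+t}$, $c_1<\cdots<c_n$, whose $N=n+2s+t$ entries are exactly $1,\ldots,N$, each once. Bully path procedure: initially all entries are available. First, each entry of row 1 starts a bully path; then each still-available entry of row 2 starts a bully path. An entry $x$ on a path bullies the smallest available entry of the next row larger than $x$, or, if there is none, the smallest available entry of the next row (a wrapping); bullied entries become unavailable and the path continues to row 3. Endpoints of paths starting in row 1 get label 1, those starting in row 2 get label 2, remaining entries of row 3 get label 3. The projected word is $\omega=(\omega_1,\ldots,\omega_n)$, $\omega_k$ being the label of $c_k$. $n_{x,y}(s,t,n)$ denotes the number of continuous multiline queues of type $(s,t,n-s-t)$ with $c_n=N$ (the largest entry in the last row) whose projected word satisfies $\omega_1=x$ and $\omega_2=y$. $f_{(a,b)}$ denotes the number of standard Young tableaux of shape $(a,b)$ (for $a\ge b\ge 0$ it equals $\frac{a-b+1}{a+1}\binom{a+b}{a}$), taken to be $0$ when $(a,b)$ is not a partition. -}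

module Defs where

open import Data.Nat using (ℕ; zero; suc; _+_; _*_; _∸_; _≤_; _<_; _≟_; _<?_; _≤?_)
open import Data.Nat.Combinatorics using (_C_)
open import Data.Bool using (Bool; true; false; if_then_else_)
open import Data.List using (List; []; _∷_; _++_; length; filter; applyUpTo; concatMap; map; zip; foldl; last; take)
import Data.List.Properties as LP
import Data.Maybe.Properties as MP
open import Data.Maybe using (Maybe; just; nothing)
open import Data.Product using (_×_; _,_; proj₁; proj₂)
open import Data.Vec using (Vec; toList) renaming ([] to []ᵥ; _∷_ to _∷ᵥ_)
open import Data.List.Relation.Unary.Linked using (Linked; linked?)
open import Data.List.Relation.Unary.All using (All; all?)
open import Relation.Binary.PropositionalEquality using (_≡_)
open import Relation.Nullary using (Dec; yes; no; does)
open import Relation.Nullary.Decidable using (_×-dec_)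

range : ℕ → List ℕ
range N = applyUpTo suc N

allVecs : (N k : ℕ) → List (Vec ℕ k)
allVecs N zero    = []ᵥ ∷ []
allVecs N (suc k) = concatMap (λ x → map (x ∷ᵥ_) (allVecs N k)) (range N)

occ : ℕ → List ℕ → ℕ
occ k xs = length (filter (_≟ k) xs)

ExactlyOnce : ℕ → List ℕ → Set
ExactlyOnce N L = All (λ x → 1 ≤ x × x ≤ N) L × All (λ k → occ k L ≡ 1) (range N)

exactlyOnce? : (N : ℕ) (L : List ℕ) → Dec (ExactlyOnce N L)
exactlyOnce? N L =
  all? (λ x → (1 ≤? x) ×-dec (x ≤? N)) L ×-dec all? (λ k → occ k L ≟ 1) (range N)

StrictlyIncreasing : List ℕ → Set
StrictlyIncreasing = Linked _<_

-- Continuous multiline queues of type (s, t, n-s-t): three rows of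
-- lengths s, s+t, n; N = n + 2s + t.

bigN : (s t n : ℕ) → ℕ
bigN s t n = n + 2 * s + t

Triple : (s t n : ℕ) → Set
Triple s t n = Vec ℕ s × Vec ℕ (s + t) × Vec ℕ n

row1 row2 row3 : ∀ {s t n} → Triple s t n → List ℕ
row1 (a , b , c) = toList a
row2 (a , b , c) = toList b
row3 (a , b , c) = toList c

IsCMLQ : (s t n : ℕ) → Triple s t n → Set
IsCMLQ s t n q =
  StrictlyIncreasing (row1 q) × StrictlyIncreasing (row2 q) ×
  StrictlyIncreasing (row3 q) ×
  ExactlyOnce (bigN s t n) (row1 q ++ row2 q ++ row3 q)

isCMLQ? : (s t n : ℕ) (q : Triple s t n) → Dec (IsCMLQ s t n q)
isCMLQ? s t n q =
  linked? _<?_ (row1 q) ×-dec linked? _<?_ (row2 q) ×-dec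
  linked? _<?_ (row3 q) ×-dec exactlyOnce? (bigN s t n) (row1 q ++ row2 q ++ row3 q)

allTriples : (s t n : ℕ) → List (Triple s t n)
allTriples s t n =
  concatMap (λ a → concatMap (λ b → map (λ c → a , b , c) (allVecs N n))
                             (allVecs N (s + t)))
            (allVecs N s)
  where N = bigN s t n

-- Bully paths.  Available entries of a row are kept as a list in
-- increasing order.

-- remove the first available entry larger than x (= the smallest such,
-- as the list is increasing)
pickGt : ℕ → List ℕ → Maybe (ℕ × List ℕ)
pickGt x [] = nothing
pickGt x (y ∷ ys) with does (x <? y)
... | true  = just (y , ys)
... | false with pickGt x ys
...   | nothing         = nothing
...   | just (z , zs)   = just (z , y ∷ zs)

bully : ℕ → List ℕ → Maybe (ℕ × List ℕ)
bully x ys with pickGt x ys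
... | just p  = just p
... | nothing with ys
...   | []       = nothing
...   | y ∷ ys'  = just (y , ys')

-- state: available row 2, available row 3, (endpoint , label) records
State : Set
State = List ℕ × List ℕ × List (ℕ × ℕ)

step1 : State → ℕ → State
step1 (av2 , av3 , rec) a with bully a av2
... | nothing = (av2 , av3 , rec)
... | just (y , av2') with bully y av3
...   | nothing = (av2' , av3 , rec)
...   | just (z , av3') = (av2' , av3' , (z , 1) ∷ rec)

step2 : List ℕ → List (ℕ × ℕ) → ℕ → List ℕ × List (ℕ × ℕ)
step2 av3 rec b with bully b av3
... | nothing = (av3 , rec)
... | just (z , av3') = (av3' , (z , 2) ∷ rec)

labelOf : List (ℕ × ℕ) → ℕ → ℕ
labelOf [] c = 3
labelOf ((z , l) ∷ rec) c = if does (z ≟ c) then l else labelOf rec c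

-- projected word (ω₁, ..., ωₙ): labels of c₁ < ... < cₙ
-- Row-1 paths are run (in increasing order of their start) before the
-- row-2 paths, which start at the still-available row-2 entries (in
-- increasing order).
projWord : ∀ {s t n} → Triple s t n → List ℕ
projWord q =
  let st1 = foldl step1 (row2 q , row3 q , []) (row1 q)
      av2 = proj₁ st1
      av3 = proj₁ (proj₂ st1)
      rec1 = proj₂ (proj₂ st1)
      st2 = foldl (λ p b → step2 (proj₁ p) (proj₂ p) b) (av3 , rec1) av2
  in map (labelOf (proj₂ st2)) (row3 q)

Good : (x y s t n : ℕ) → Triple s t n → Set
Good x y s t n q =
  IsCMLQ s t n q × last (row3 q) ≡ just (bigN s t n) ×
  take 2 (projWord q) ≡ x ∷ y ∷ []

good? : (x y s t n : ℕ) (q : Triple s t n) → Dec (Good x y s t n q)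
good? x y s t n q =
  isCMLQ? s t n q ×-dec MP.≡-dec _≟_ (last (row3 q)) (just (bigN s t n)) ×-dec
  LP.≡-dec _≟_ (take 2 (projWord q)) (x ∷ y ∷ [])

nxy : (x y s t n : ℕ) → ℕ
nxy x y s t n = length (filter (good? x y s t n) (allTriples s t n))

IsSYT : (a b : ℕ) → Vec ℕ a × Vec ℕ b → Set
IsSYT a b (r , r') =
  b ≤ a × StrictlyIncreasing (toList r) × StrictlyIncreasing (toList r') ×
  All (λ p → proj₁ p < proj₂ p) (zip (toList r) (toList r')) ×
  ExactlyOnce (a + b) (toList r ++ toList r')

isSYT? : (a b : ℕ) (T : Vec ℕ a × Vec ℕ b) → Dec (IsSYT a b T)
isSYT? a b (r , r') =
  (b ≤? a) ×-dec linked? _<?_ (toList r) ×-dec linked? _<?_ (toList r') ×-dec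
  all? (λ p → proj₁ p <? proj₂ p) (zip (toList r) (toList r')) ×-dec
  exactlyOnce? (a + b) (toList r ++ toList r')

f : ℕ → ℕ → ℕ
f a b = length (filter (isSYT? a b)
          (concatMap (λ r → map (r ,_) (allVecs (a + b) b)) (allVecs (a + b) a)))

-- Write row 3 as c₁ < c₂ < ⋯ < cₙ. The labels ω₁ = ω₂ = 3 say that c₁ and c₂ are never bullied, which
-- happens exactly when every row-2 entry exceeds c₂ and no path into row 3 wraps. Bullying the least larger
-- entry is a greedy matching, so "no wrap" is Hall's condition for matching the row-2 entries with distinct
-- larger row-3 entries; a row-1 path merely removes a row-2 entry and then matches it greedily, so the
-- condition does not involve row 1 at all. Now rank the entries outside row 1 downwards (N gets rank 1):
-- c₁ and c₂ receive the two largest ranks, and the rank images of c₃ … cₙ and of row 2, read backwards,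
-- are the rows of a standard Young tableau of shape (n-2, s+t), Hall's condition turning into column
-- strictness and cₙ = N into the fact that 1 sits in the corner. Row 1 is an arbitrary s-subset of
-- {1, …, N-1}, which gives the factor binom(N-1, s).

module Submission where

open import Defs
open import Data.Nat
  using (ℕ; zero; suc; _+_; _*_; _∸_; _≤_; _<_; _>_; z≤n; s≤s; s≤s⁻¹; _≟_; _<?_; _≤?_; _<ᵇ_; _≡ᵇ_)
open import Data.Bool using (true; false)
open import Data.Maybe using (Maybe; just; nothing)
open import Data.Nat.Properties
open import Data.Nat.Solver using (module +-*-Solver)
open import Data.Nat.Combinatorics using (_C_; nCk+nC[k+1]≡[n+1]C[k+1])
open import Data.List using (List; []; _∷_; _++_; length; filter; map; concatMap; reverse; zip; last; foldl; [_]; _∷ʳ_)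
open import Data.List.Properties
  using (filter-++; length-++; length-map; length-filter; length-reverse; length-applyUpTo; unfold-reverse;
         reverse-map; reverse-involutive; reverse-++; map-++; map-∘; map-id-local; ∷-injectiveˡ; ∷-injectiveʳ)
open import Data.List.Membership.Propositional using (_∈_; _∉_)
open import Data.List.Membership.DecPropositional _≟_ using (_∈?_; _∉?_)
open import Data.List.Membership.Propositional.Properties
  using (∈-filter⁺; ∈-filter⁻; ∈-map⁺; ∈-map⁻; ∈-++⁺ˡ; ∈-++⁺ʳ; ∈-++⁻; ∈-concatMap⁺; ∈-concatMap⁻; ∈-applyUpTo⁺; ∈-applyUpTo⁻)
open import Data.List.Relation.Unary.Any as Any using (Any; here; there)
import Data.List.Relation.Unary.Any.Properties as AnyP
open import Data.List.Relation.Unary.All as All using (All; []; _∷_)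
import Data.List.Relation.Unary.All.Properties as AllP
open import Data.List.Relation.Unary.AllPairs as AllPairs using (AllPairs; []; _∷_)
import Data.List.Relation.Unary.AllPairs.Properties as AllPairsP
open import Data.List.Relation.Unary.Linked as Linked using (Linked; linked?)
import Data.List.Relation.Unary.Linked.Properties as LinkedP
open import Data.List.Relation.Unary.Unique.Propositional using (Unique)
import Data.List.Relation.Unary.Unique.Propositional.Properties as UniqueP
open import Data.Vec as Vec using (Vec; toList) renaming ([] to []ᵥ; _∷_ to _∷ᵥ_)
import Data.Vec.Properties as Vecₚ
open import Data.Product using (_×_; _,_; proj₁; proj₂; ∃)
open import Data.Sum using (_⊎_; inj₁; inj₂)
open import Data.Empty using (⊥; ⊥-elim)
open import Data.Unit using (tt)
open import Function using (id; _∘_; flip)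
open import Relation.Binary.PropositionalEquality hiding ([_])
open import Relation.Binary.Definitions using (tri<; tri≈; tri>)
open import Relation.Nullary using (Dec; yes; no; ¬_)
open import Relation.Nullary.Decidable using (_×-dec_)
open import Relation.Nullary.Reflects using (Reflects; ofʸ; ofⁿ; fromEquivalence)
open import Relation.Unary using (Decidable)

module _ {A : Set} where

  data Removal (z : A) : List A → List A → Set where
    rhere  : ∀ {ys} → Removal z (z ∷ ys) ys
    rthere : ∀ {y ys zs} → Removal z ys zs → Removal z (y ∷ ys) (y ∷ zs)

  removed-∈ : ∀ {z ys zs} → Removal z ys zs → z ∈ ys
  removed-∈ rhere = here refl
  removed-∈ (rthere r) = there (removed-∈ r)

  removal-⊆ : ∀ {z ys zs w} → Removal z ys zs → w ∈ zs → w ∈ ys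
  removal-⊆ rhere w∈ = there w∈
  removal-⊆ (rthere r) (here p) = here p
  removal-⊆ (rthere r) (there w∈) = there (removal-⊆ r w∈)

  removal-⊇ : ∀ {z ys zs w} → Removal z ys zs → w ∈ ys → w ≡ z ⊎ w ∈ zs
  removal-⊇ rhere (here p) = inj₁ p
  removal-⊇ rhere (there w∈) = inj₂ w∈
  removal-⊇ (rthere r) (here p) = inj₂ (here p)
  removal-⊇ (rthere r) (there w∈) with removal-⊇ r w∈
  ... | inj₁ p = inj₁ p
  ... | inj₂ q = inj₂ (there q)

  ∈⇒removal : ∀ {z ys} → z ∈ ys → ∃ λ zs → Removal z ys zs
  ∈⇒removal (here refl) = _ , rhere
  ∈⇒removal (there p) with ∈⇒removal p
  ... | zs , r = _ , rthere r

  removal-length : ∀ {z ys zs} → Removal z ys zs → length ys ≡ suc (length zs)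
  removal-length rhere = refl
  removal-length (rthere r) = cong suc (removal-length r)

  removal-All⁻ : ∀ {P : A → Set} {z ys zs} → Removal z ys zs → All P ys → All P zs
  removal-All⁻ rhere (_ ∷ ps) = ps
  removal-All⁻ (rthere r) (p ∷ ps) = p ∷ removal-All⁻ r ps

  removal-All⁺ : ∀ {P : A → Set} {z ys zs} → Removal z ys zs → P z → All P zs → All P ys
  removal-All⁺ rhere pz ps = pz ∷ ps
  removal-All⁺ (rthere r) pz (p ∷ ps) = p ∷ removal-All⁺ r pz ps

  removal-AllPairs : ∀ {R : A → A → Set} {z ys zs} → Removal z ys zs → AllPairs R ys → AllPairs R zs
  removal-AllPairs rhere (_ ∷ ps) = ps
  removal-AllPairs (rthere r) (p ∷ ps) = removal-All⁻ r p ∷ removal-AllPairs r ps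

  removed-related : ∀ {R : A → A → Set} {z ys zs} → Removal z ys zs → AllPairs R ys →
                    ∀ {w} → w ∈ zs → R z w ⊎ R w z
  removed-related rhere (p ∷ ps) w∈ = inj₁ (All.lookup p w∈)
  removed-related (rthere r) (p ∷ ps) (here refl) = inj₂ (All.lookup p (removed-∈ r))
  removed-related (rthere r) (p ∷ ps) (there w∈) = removed-related r ps w∈

count : {A : Set} {P : A → Set} → Decidable P → List A → ℕ
count P? xs = length (filter P? xs)

module _ {A : Set} {P : A → Set} (P? : Decidable P) where

  count-++ : ∀ xs ys → count P? (xs ++ ys) ≡ count P? xs + count P? ys
  count-++ xs ys = trans (cong length (filter-++ P? xs ys)) (length-++ (filter P? xs))

  count-removal-yes : ∀ {z ys zs} → Removal z ys zs → P z → count P? ys ≡ suc (count P? zs)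
  count-removal-yes {z} rhere pz with P? z
  ... | yes _ = refl
  ... | no ¬p = ⊥-elim (¬p pz)
  count-removal-yes (rthere {y = y} r) pz with P? y
  ... | yes _ = cong suc (count-removal-yes r pz)
  ... | no _ = count-removal-yes r pz

  count-removal-no : ∀ {z ys zs} → Removal z ys zs → ¬ P z → count P? ys ≡ count P? zs
  count-removal-no {z} rhere ¬pz with P? z
  ... | yes p = ⊥-elim (¬pz p)
  ... | no _ = refl
  count-removal-no (rthere {y = y} r) ¬pz with P? y
  ... | yes _ = cong suc (count-removal-no r ¬pz)
  ... | no _ = count-removal-no r ¬pz

  count-removal-≤ : ∀ {z ys zs} → Removal z ys zs → count P? zs ≤ count P? ys
  count-removal-≤ {z} r with P? z
  ... | yes p = ≤-trans (n≤1+n _) (≤-reflexive (sym (count-removal-yes r p)))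
  ... | no ¬p = ≤-reflexive (sym (count-removal-no r ¬p))

  count-none : ∀ {xs} → All (λ x → ¬ P x) xs → count P? xs ≡ 0
  count-none [] = refl
  count-none {x ∷ _} (h ∷ hs) with P? x
  ... | yes p = ⊥-elim (h p)
  ... | no _ = count-none hs

  count-all : ∀ {xs} → All P xs → count P? xs ≡ length xs
  count-all [] = refl
  count-all {x ∷ _} (p ∷ ps) with P? x
  ... | yes _ = cong suc (count-all ps)
  ... | no ¬p = ⊥-elim (¬p p)

  count-pos : ∀ {x xs} → x ∈ xs → P x → 1 ≤ count P? xs
  count-pos x∈ px with ∈⇒removal x∈
  ... | _ , r = subst (1 ≤_) (sym (count-removal-yes r px)) (s≤s z≤n)

  count-pos⁻ : ∀ xs → 1 ≤ count P? xs → ∃ λ x → x ∈ xs × P x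
  count-pos⁻ (x ∷ xs) h with P? x
  ... | yes p = x , here refl , p
  ... | no _ with count-pos⁻ xs h
  ...   | y , y∈ , py = y , there y∈ , py

  count-reverse : ∀ xs → count P? (reverse xs) ≡ count P? xs
  count-reverse [] = refl
  count-reverse (x ∷ xs) = begin
    count P? (reverse (x ∷ xs))         ≡⟨ cong (count P?) (unfold-reverse x xs) ⟩
    count P? (reverse xs ++ [ x ])      ≡⟨ count-++ (reverse xs) [ x ] ⟩
    count P? (reverse xs) + count P? [ x ] ≡⟨ cong (_+ count P? [ x ]) (count-reverse xs) ⟩
    count P? xs + count P? [ x ]        ≡⟨ +-comm (count P? xs) _ ⟩
    count P? [ x ] + count P? xs        ≡⟨ sym (count-++ [ x ] xs) ⟩
    count P? (x ∷ xs)                   ∎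
    where open ≡-Reasoning

count-mono : {A : Set} {P Q : A → Set} (P? : Decidable P) (Q? : Decidable Q) →
             ∀ {xs} → All (λ x → P x → Q x) xs → count P? xs ≤ count Q? xs
count-mono P? Q? [] = z≤n
count-mono P? Q? {x ∷ _} (h ∷ hs) with P? x | Q? x
... | yes p | yes q = s≤s (count-mono P? Q? hs)
... | yes p | no ¬q = ⊥-elim (¬q (h p))
... | no ¬p | yes q = m≤n⇒m≤1+n (count-mono P? Q? hs)
... | no ¬p | no ¬q = count-mono P? Q? hs

module _ {A : Set} where

  Unique-⊆⇒length-≤ : ∀ (xs ys : List A) → Unique xs → (∀ {x} → x ∈ xs → x ∈ ys) → length xs ≤ length ys
  Unique-⊆⇒length-≤ [] ys _ _ = z≤n
  Unique-⊆⇒length-≤ (x ∷ xs) ys (x∉xs ∷ u) xs⊆ys with ∈⇒removal (xs⊆ys (here refl))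
  ... | ys' , r = subst (suc (length xs) ≤_) (sym (removal-length r))
                    (s≤s (Unique-⊆⇒length-≤ xs ys' u (λ w∈ → survives w∈ (removal-⊇ r (xs⊆ys (there w∈))))))
    where
    survives : ∀ {w} → w ∈ xs → w ≡ x ⊎ w ∈ ys' → w ∈ ys'
    survives w∈ (inj₁ refl) = ⊥-elim (All.lookup x∉xs w∈ refl)
    survives w∈ (inj₂ q) = q

module _ {A B : Set} where

  Unique-map⁺-retract : (φ : A → B) (ψ : B → A) {xs : List A} → Unique xs →
                        (∀ {x} → x ∈ xs → ψ (φ x) ≡ x) → Unique (map φ xs)
  Unique-map⁺-retract φ ψ [] _ = []
  Unique-map⁺-retract φ ψ (u ∷ us) inv =
    AllP.map⁺ (All.tabulate λ {y} y∈ eq → All.lookup u y∈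
      (trans (sym (inv (here refl))) (trans (cong ψ eq) (inv (there y∈)))))
    ∷ Unique-map⁺-retract φ ψ us (λ x∈ → inv (there x∈))

  Unique-concatMap⁺ : (F : A → List B) {xs : List A} → Unique xs → (∀ x → Unique (F x)) →
                      (∀ {x y b} → b ∈ F x → b ∈ F y → x ≡ y) → Unique (concatMap F xs)
  Unique-concatMap⁺ F [] _ _ = []
  Unique-concatMap⁺ F {x ∷ xs} (u ∷ us) uF disj =
    UniqueP.++⁺ (uF x) (Unique-concatMap⁺ F us uF disj)
      (λ (b∈Fx , b∈rest) → apart u b∈Fx (∈-concatMap⁻ F {xs = xs} b∈rest))
    where
    apart : ∀ {ys b} → All (x ≢_) ys → b ∈ F x → Any (λ y → b ∈ F y) ys → ⊥
    apart (x≢y ∷ _) b∈ (here b∈') = x≢y (disj b∈ b∈')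
    apart (_ ∷ ne) b∈ (there a) = apart ne b∈ a

module _ {A B : Set} {P : A → Set} {Q : B → Set} (P? : Decidable P) (Q? : Decidable Q) where

  count-≤-retract : (xs : List A) (ys : List B) → Unique xs → (φ : A → B) (ψ : B → A) →
    (∀ {x} → x ∈ xs → P x → φ x ∈ ys × Q (φ x) × ψ (φ x) ≡ x) →
    count P? xs ≤ count Q? ys
  count-≤-retract xs ys ux φ ψ h =
    subst (_≤ count Q? ys) (length-map φ (filter P? xs))
      (Unique-⊆⇒length-≤ (map φ (filter P? xs)) (filter Q? ys)
        (Unique-map⁺-retract φ ψ (UniqueP.filter⁺ P? ux)
           (λ x∈ → let (x∈xs , px) = ∈-filter⁻ P? x∈ in proj₂ (proj₂ (h x∈xs px))))
        λ y∈ → let (x , x∈ , eq) = ∈-map⁻ φ y∈ ; (x∈xs , px) = ∈-filter⁻ P? x∈ ; (φx∈ , qφx , _) = h x∈xs px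
               in subst (_∈ filter Q? ys) (sym eq) (∈-filter⁺ Q? φx∈ qφx))

count-bijection : {A B : Set} {P : A → Set} {Q : B → Set} (P? : Decidable P) (Q? : Decidable Q)
  (xs : List A) (ys : List B) → Unique xs → Unique ys → (φ : A → B) (ψ : B → A) →
  (∀ {x} → x ∈ xs → P x → φ x ∈ ys × Q (φ x) × ψ (φ x) ≡ x) →
  (∀ {y} → y ∈ ys → Q y → ψ y ∈ xs × P (ψ y) × φ (ψ y) ≡ y) →
  count P? xs ≡ count Q? ys
count-bijection P? Q? xs ys ux uy φ ψ φ-ok ψ-ok =
  ≤-antisym (count-≤-retract P? Q? xs ys ux φ ψ φ-ok) (count-≤-retract Q? P? ys xs uy ψ φ ψ-ok)

Sorted : List ℕ → Set
Sorted = AllPairs _<_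

Descending : List ℕ → Set
Descending = AllPairs _>_

Linked⇒Sorted : ∀ {xs} → Linked _<_ xs → Sorted xs
Linked⇒Sorted = LinkedP.Linked⇒AllPairs <-trans

count≥ : ℕ → List ℕ → ℕ
count≥ v = count (v ≤?_)

count> : ℕ → List ℕ → ℕ
count> v = count (v <?_)

-- Hall's condition for matching every entry of Y with a distinct strictly larger entry of A.
Hall : List ℕ → List ℕ → Set
Hall Y A = ∀ v → count≥ v Y ≤ count> v A

Hall-no-wrap : ∀ {y Y A} → Hall Y A → y ∈ Y → All (_≤ y) A → ⊥
Hall-no-wrap {y} {Y} {A} h y∈ A≤y =
  <⇒≱ (≤-trans (count-pos (y ≤?_) y∈ ≤-refl) (h y))
      (≤-reflexive (count-none (y <?_) (All.map (λ w≤y y<w → <⇒≱ y<w w≤y) A≤y)))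

Hall-bully : ∀ {y Y Y' z A A'} → Removal y Y Y' → Hall Y A → Sorted A → Removal z A A' → y < z →
             All (λ w → y < w → z ≤ w) A → Hall Y' A'
Hall-bully {y} {Y} {Y'} {z} {A} {A'} rY h sA rA y<z z-least v with v ≤? y
... | yes v≤y = s≤s⁻¹ (subst₂ _≤_ (count-removal-yes (v ≤?_) rY v≤y)
                                  (count-removal-yes (v <?_) rA (≤-<-trans v≤y y<z)) (h v))
... | no v≰y with z ≤? v
...   | yes z≤v = subst₂ _≤_ (count-removal-no (v ≤?_) rY v≰y) (count-removal-no (v <?_) rA (≤⇒≯ z≤v)) (h v)
...   | no z≰v = begin
        count≥ v Y' ≤⟨ count-mono (v ≤?_) (y ≤?_) {Y'} (All.tabulate λ _ v≤w → ≤-trans (<⇒≤ y<v) v≤w) ⟩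
        count≥ y Y' ≤⟨ s≤s⁻¹ (subst₂ _≤_ (count-removal-yes (y ≤?_) rY ≤-refl)
                                          (count-removal-yes (y <?_) rA y<z) (h y)) ⟩
        count> y A' ≤⟨ count-mono (y <?_) (v <?_) {A'} (All.tabulate above-y⇒above-v) ⟩
        count> v A' ∎
  where
  open ≤-Reasoning
  y<v : y < v
  y<v = ≰⇒> v≰y
  v<z : v < z
  v<z = ≰⇒> z≰v
  above-y⇒above-v : ∀ {w} → w ∈ A' → y < w → v < w
  above-y⇒above-v w∈ y<w with removed-related rA sA w∈
  ... | inj₁ z<w = <-trans v<z z<w
  ... | inj₂ w<z = ⊥-elim (<⇒≱ w<z (All.lookup z-least (removal-⊆ rA w∈) y<w))

Hall-unbully : ∀ {y Y Y' z A A'} → Removal y Y Y' → Removal z A A' → y < z → Hall Y' A' → Hall Y A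
Hall-unbully {y} {Y} {Y'} {z} {A} {A'} rY rA y<z h v with v ≤? y
... | yes v≤y = subst₂ _≤_ (sym (count-removal-yes (v ≤?_) rY v≤y))
                          (sym (count-removal-yes (v <?_) rA (≤-<-trans v≤y y<z))) (s≤s (h v))
... | no v≰y = subst (_≤ count> v A) (sym (count-removal-no (v ≤?_) rY v≰y))
                     (≤-trans (h v) (count-removal-≤ (v <?_) rA))

data PickGtView (x : ℕ) (ys : List ℕ) : Maybe (ℕ × List ℕ) → Set where
  nothing-larger : All (_≤ x) ys → PickGtView x ys nothing
  least-larger   : ∀ {z zs} → Removal z ys zs → x < z → (Sorted ys → All (λ w → x < w → z ≤ w) ys) →
                   PickGtView x ys (just (z , zs))

pickGt-view : ∀ x ys → PickGtView x ys (pickGt x ys)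
pickGt-view x [] = nothing-larger []
pickGt-view x (y ∷ ys) with x <ᵇ y | <ᵇ-reflects-< x y
... | true | ofʸ x<y =
      least-larger rhere x<y (λ { (y<ys ∷ _) → (λ _ → ≤-refl) ∷ All.map (λ y<w _ → <⇒≤ y<w) y<ys })
... | false | ofⁿ x≮y with pickGt x ys | pickGt-view x ys
...   | nothing | nothing-larger ys≤x = nothing-larger (≮⇒≥ x≮y ∷ ys≤x)
...   | just _ | least-larger r x<z z-least =
        least-larger (rthere r) x<z (λ { (_ ∷ s) → (λ x<y → ⊥-elim (x≮y x<y)) ∷ z-least s })

data BullyView (x : ℕ) (ys : List ℕ) : Maybe (ℕ × List ℕ) → Set where
  bullies-larger : ∀ {z zs} → Removal z ys zs → x < z → (Sorted ys → All (λ w → x < w → z ≤ w) ys) →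
                   BullyView x ys (just (z , zs))
  wraps          : ∀ {z zs} → All (_≤ x) ys → ys ≡ z ∷ zs → BullyView x ys (just (z , zs))
  nobody         : ys ≡ [] → BullyView x ys nothing

bully-view : ∀ x ys → BullyView x ys (bully x ys)
bully-view x [] = nobody refl
bully-view x (y ∷ ys) with pickGt x (y ∷ ys) | pickGt-view x (y ∷ ys)
... | nothing | nothing-larger ys≤x = wraps ys≤x refl
... | just _ | least-larger r x<z z-least = bullies-larger r x<z z-least

bully-removal : ∀ {x ys z zs} → BullyView x ys (just (z , zs)) → Removal z ys zs
bully-removal (bullies-larger r _ _) = r
bully-removal (wraps _ refl) = rhere

runRow2 : List ℕ → List (ℕ × ℕ) → List ℕ → List (ℕ × ℕ)
runRow2 av3 rec bs = proj₂ (foldl (λ p b → step2 (proj₁ p) (proj₂ p) b) (av3 , rec) bs)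

-- The record list built inside projWord, definitionally.
runPaths : List ℕ → List ℕ → List (ℕ × ℕ) → List ℕ → List (ℕ × ℕ)
runPaths av2 av3 rec as = let (av2' , av3' , rec') = foldl step1 (av2 , av3 , rec) as in
  runRow2 av3' rec' av2'

record Unlabelled (c : ℕ) (rec : List (ℕ × ℕ)) : Set where
  constructor unlabelled
  field label≡3 : labelOf rec c ≡ 3

≡ᵇ-reflects-≡ : ∀ m n → Reflects (m ≡ n) (m ≡ᵇ n)
≡ᵇ-reflects-≡ m n = fromEquivalence (≡ᵇ⇒≡ m n) (≡⇒≡ᵇ m n)

Unlabelled-∷⁻ : ∀ {z l rec c} → l ≢ 3 → Unlabelled c ((z , l) ∷ rec) → z ≢ c × Unlabelled c rec
Unlabelled-∷⁻ {z} {l} {rec} {c} l≢3 (unlabelled eq) with z ≡ᵇ c | ≡ᵇ-reflects-≡ z c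
... | true | ofʸ _ = ⊥-elim (l≢3 eq)
... | false | ofⁿ z≢c = z≢c , unlabelled eq

Unlabelled-∷⁺ : ∀ {z l rec c} → z ≢ c → Unlabelled c rec → Unlabelled c ((z , l) ∷ rec)
Unlabelled-∷⁺ {z} {l} {rec} {c} z≢c (unlabelled eq) = unlabelled (go eq)
  where
  go : labelOf rec c ≡ 3 → labelOf ((z , l) ∷ rec) c ≡ 3
  go eq with z ≡ᵇ c | ≡ᵇ-reflects-≡ z c
  ... | true | ofʸ z≡c = ⊥-elim (z≢c z≡c)
  ... | false | ofⁿ _ = eq

module TwoSmallest (c₁ c₂ : ℕ) (c₁<c₂ : c₁ < c₂) where

  bully-keeps-unlabelled : ∀ {y Y Y' z A A' rec l} → Removal y Y Y' → BullyView y A (just (z , A')) →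
    Sorted A → Hall Y A → All (c₂ <_) Y → Unlabelled c₁ rec → Unlabelled c₂ rec →
    Sorted A' × Hall Y' A' × All (c₂ <_) Y' × Unlabelled c₁ ((z , l) ∷ rec) × Unlabelled c₂ ((z , l) ∷ rec)
  bully-keeps-unlabelled rY (wraps A≤y _) sA h _ _ _ = ⊥-elim (Hall-no-wrap h (removed-∈ rY) A≤y)
  bully-keeps-unlabelled {z = z} rY (bullies-larger r y<z z-least) sA h Y>c₂ u₁ u₂ =
    removal-AllPairs r sA , Hall-bully rY h sA r y<z (z-least sA) , removal-All⁻ rY Y>c₂ ,
    Unlabelled-∷⁺ (λ z≡c₁ → <-asym c₂<z (subst (_< c₂) (sym z≡c₁) c₁<c₂)) u₁ ,
    Unlabelled-∷⁺ (λ z≡c₂ → <-irrefl (sym z≡c₂) c₂<z) u₂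
    where
    c₂<z : c₂ < z
    c₂<z = <-trans (All.lookup Y>c₂ (removed-∈ rY)) y<z

  row2-keeps-unlabelled : ∀ bs av3 rec → Sorted av3 → Hall bs av3 → All (c₂ <_) bs →
    Unlabelled c₁ rec → Unlabelled c₂ rec →
    Unlabelled c₁ (runRow2 av3 rec bs) × Unlabelled c₂ (runRow2 av3 rec bs)
  row2-keeps-unlabelled [] av3 rec sA h bs>c₂ u₁ u₂ = u₁ , u₂
  row2-keeps-unlabelled (y ∷ bs) av3 rec sA h bs>c₂ u₁ u₂ with bully y av3 | bully-view y av3
  ... | nothing | nobody refl = ⊥-elim (Hall-no-wrap h (here refl) [])
  ... | just (z , A') | v with bully-keeps-unlabelled {l = 2} rhere v sA h bs>c₂ u₁ u₂
  ...   | sA' , h' , bs'>c₂ , u₁' , u₂' = row2-keeps-unlabelled bs A' ((z , 2) ∷ rec) sA' h' bs'>c₂ u₁' u₂'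

  paths-keep-unlabelled : ∀ as av2 av3 rec → Sorted av3 → Hall av2 av3 → All (c₂ <_) av2 →
    Unlabelled c₁ rec → Unlabelled c₂ rec →
    Unlabelled c₁ (runPaths av2 av3 rec as) × Unlabelled c₂ (runPaths av2 av3 rec as)
  paths-keep-unlabelled [] av2 av3 rec = row2-keeps-unlabelled av2 av3 rec
  paths-keep-unlabelled (a ∷ as) av2 av3 rec sA h av2>c₂ u₁ u₂ with bully a av2 | bully-view a av2
  ... | nothing | _ = paths-keep-unlabelled as av2 av3 rec sA h av2>c₂ u₁ u₂
  ... | just (y , av2') | va with bully y av3 | bully-view y av3
  ...   | nothing | nobody refl = ⊥-elim (Hall-no-wrap h (removed-∈ (bully-removal va)) [])
  ...   | just (z , A') | v with bully-keeps-unlabelled {l = 1} (bully-removal va) v sA h av2>c₂ u₁ u₂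
  ...     | sA' , h' , av2'>c₂ , u₁' , u₂' = paths-keep-unlabelled as av2' A' ((z , 1) ∷ rec) sA' h' av2'>c₂ u₁' u₂'

  NothingElseBelowC₂ : List ℕ → Set
  NothingElseBelowC₂ = All (λ w → w ≡ c₁ ⊎ w ≡ c₂ ⊎ c₂ < w)

  Reserved : ℕ → List ℕ → List (ℕ × ℕ) → Set
  Reserved c A rec = Unlabelled c rec → c ∈ A

  reserved-after-removal : ∀ {z A A' c rec} → Removal z A A' → z ≢ c → Unlabelled c rec →
                           Reserved c A rec → c ∈ A'
  reserved-after-removal r z≢c u c∈A with removal-⊇ r (c∈A u)
  ... | inj₁ c≡z = ⊥-elim (z≢c (sym c≡z))
  ... | inj₂ c∈A' = c∈A'

  bully-invariants : ∀ {y z A A' rec l} → l ≢ 3 → BullyView y A (just (z , A')) → Sorted A → NothingElseBelowC₂ A →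
    Reserved c₁ A rec → Reserved c₂ A rec →
    Sorted A' × NothingElseBelowC₂ A' × Reserved c₁ A' ((z , l) ∷ rec) × Reserved c₂ A' ((z , l) ∷ rec)
  bully-invariants l≢3 v sA shA res₁ res₂ =
    removal-AllPairs r sA , removal-All⁻ r shA ,
    (λ u → let (z≢c , u') = Unlabelled-∷⁻ l≢3 u in reserved-after-removal r z≢c u' res₁) ,
    (λ u → let (z≢c , u') = Unlabelled-∷⁻ l≢3 u in reserved-after-removal r z≢c u' res₂)
    where r = bully-removal v

  -- While c₁ and c₂ are still available, a wrapping path would bully c₁, and a path from y < c₂
  -- would bully c₁ or c₂; so an unlabelled outcome forces c₂ < y < z.
  unlabelled-bully⇒Hall : ∀ {y Y Y' z A A' rec l} → l ≢ 3 → Removal y Y Y' → BullyView y A (just (z , A')) →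
    Sorted A → NothingElseBelowC₂ A → Reserved c₁ A rec → Reserved c₂ A rec → y ≢ c₂ →
    Unlabelled c₁ ((z , l) ∷ rec) → Unlabelled c₂ ((z , l) ∷ rec) → Hall Y' A' → All (c₂ <_) Y' →
    Unlabelled c₁ rec × Unlabelled c₂ rec × Hall Y A × All (c₂ <_) Y
  unlabelled-bully⇒Hall {y} {z = z} {rec = rec} l≢3 rY (bullies-larger r y<z z-least) sA shA res₁ res₂ y≢c₂
                        u₁' u₂' h Y'>c₂ =
    u₁ , u₂ , Hall-unbully rY r y<z h , removal-All⁺ rY c₂<y Y'>c₂
    where
    z≢c₁ : z ≢ c₁
    z≢c₁ = proj₁ (Unlabelled-∷⁻ l≢3 u₁')
    u₁ : Unlabelled c₁ rec
    u₁ = proj₂ (Unlabelled-∷⁻ l≢3 u₁')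
    z≢c₂ : z ≢ c₂
    z≢c₂ = proj₁ (Unlabelled-∷⁻ l≢3 u₂')
    u₂ : Unlabelled c₂ rec
    u₂ = proj₂ (Unlabelled-∷⁻ l≢3 u₂')
    c₂<y : c₂ < y
    c₂<y with <-cmp y c₂
    ... | tri≈ _ y≡c₂ _ = ⊥-elim (y≢c₂ y≡c₂)
    ... | tri> _ _ c₂<y = c₂<y
    ... | tri< y<c₂ _ _ with All.lookup shA (removed-∈ r)
    ...   | inj₁ z≡c₁ = ⊥-elim (z≢c₁ z≡c₁)
    ...   | inj₂ (inj₁ z≡c₂) = ⊥-elim (z≢c₂ z≡c₂)
    ...   | inj₂ (inj₂ c₂<z) = ⊥-elim (<⇒≱ c₂<z (All.lookup (z-least sA) (res₂ u₂) y<c₂))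
  unlabelled-bully⇒Hall l≢3 rY (wraps A≤y refl) (z<A' ∷ _) (shz ∷ _) res₁ _ _ u₁' _ _ _
    with Unlabelled-∷⁻ l≢3 u₁'
  ... | z≢c₁ , u₁ with removal-⊇ rhere (res₁ u₁)
  ...   | inj₁ c₁≡z = ⊥-elim (z≢c₁ (sym c₁≡z))
  ...   | inj₂ c₁∈A' with shz
  ...     | inj₁ z≡c₁ = ⊥-elim (z≢c₁ z≡c₁)
  ...     | inj₂ (inj₁ z≡c₂) = ⊥-elim (<-asym c₁<c₂ (subst (_< c₁) z≡c₂ (All.lookup z<A' c₁∈A')))
  ...     | inj₂ (inj₂ c₂<z) = ⊥-elim (<-asym (<-trans c₁<c₂ c₂<z) (All.lookup z<A' c₁∈A'))

  unlabelled-row2⇒Hall : ∀ bs av3 rec → Sorted av3 → NothingElseBelowC₂ av3 → Reserved c₁ av3 rec → Reserved c₂ av3 rec →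
    All (_≢ c₂) bs → Unlabelled c₁ (runRow2 av3 rec bs) → Unlabelled c₂ (runRow2 av3 rec bs) →
    Unlabelled c₁ rec × Unlabelled c₂ rec × Hall bs av3 × All (c₂ <_) bs
  unlabelled-row2⇒Hall [] av3 rec sA shA res₁ res₂ _ u₁ u₂ = u₁ , u₂ , (λ _ → z≤n) , []
  unlabelled-row2⇒Hall (y ∷ bs) av3 rec sA shA res₁ res₂ (y≢c₂ ∷ bs≢c₂) u₁ u₂ with bully y av3 | bully-view y av3
  ... | nothing | nobody refl with unlabelled-row2⇒Hall bs [] rec sA shA res₁ res₂ bs≢c₂ u₁ u₂
  ...   | u₁' , _ with res₁ u₁'
  ...     | ()
  unlabelled-row2⇒Hall (y ∷ bs) av3 rec sA shA res₁ res₂ (y≢c₂ ∷ bs≢c₂) u₁ u₂ | just (z , A') | v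
    with bully-invariants {rec = rec} {l = 2} (λ ()) v sA shA res₁ res₂
  ... | sA' , shA' , res₁' , res₂' with unlabelled-row2⇒Hall bs A' ((z , 2) ∷ rec) sA' shA' res₁' res₂' bs≢c₂ u₁ u₂
  ...   | u₁' , u₂' , h , bs>c₂ = unlabelled-bully⇒Hall (λ ()) rhere v sA shA res₁ res₂ y≢c₂ u₁' u₂' h bs>c₂

  unlabelled-paths⇒Hall : ∀ as av2 av3 rec → Sorted av3 → NothingElseBelowC₂ av3 → Reserved c₁ av3 rec → Reserved c₂ av3 rec →
    All (_≢ c₂) av2 → Unlabelled c₁ (runPaths av2 av3 rec as) → Unlabelled c₂ (runPaths av2 av3 rec as) →
    Unlabelled c₁ rec × Unlabelled c₂ rec × Hall av2 av3 × All (c₂ <_) av2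
  unlabelled-paths⇒Hall [] av2 av3 rec = unlabelled-row2⇒Hall av2 av3 rec
  unlabelled-paths⇒Hall (a ∷ as) av2 av3 rec sA shA res₁ res₂ av2≢c₂ u₁ u₂ with bully a av2 | bully-view a av2
  ... | nothing | _ = unlabelled-paths⇒Hall as av2 av3 rec sA shA res₁ res₂ av2≢c₂ u₁ u₂
  ... | just (y , av2') | va with bully y av3 | bully-view y av3
  ...   | nothing | nobody refl
          with unlabelled-paths⇒Hall as av2' [] rec sA shA res₁ res₂ (removal-All⁻ (bully-removal va) av2≢c₂) u₁ u₂
  ...     | u₁' , _ with res₁ u₁'
  ...       | ()
  unlabelled-paths⇒Hall (a ∷ as) av2 av3 rec sA shA res₁ res₂ av2≢c₂ u₁ u₂ | just (y , av2') | va | just (z , A') | v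
    with bully-invariants {rec = rec} {l = 1} (λ ()) v sA shA res₁ res₂
  ... | sA' , shA' , res₁' , res₂'
        with unlabelled-paths⇒Hall as av2' A' ((z , 1) ∷ rec) sA' shA' res₁' res₂'
               (removal-All⁻ (bully-removal va) av2≢c₂) u₁ u₂
  ...   | u₁' , u₂' , h , av2'>c₂ =
          unlabelled-bully⇒Hall (λ ()) (bully-removal va) v sA shA res₁ res₂
            (All.lookup av2≢c₂ (removed-∈ (bully-removal va))) u₁' u₂' h av2'>c₂

Hall⇒two-smallest-unlabelled : ∀ as bs c₁ c₂ cs → Linked _<_ (c₁ ∷ c₂ ∷ cs) →
  Hall bs (c₁ ∷ c₂ ∷ cs) → All (c₂ <_) bs →
  labelOf (runPaths bs (c₁ ∷ c₂ ∷ cs) [] as) c₁ ≡ 3 × labelOf (runPaths bs (c₁ ∷ c₂ ∷ cs) [] as) c₂ ≡ 3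
Hall⇒two-smallest-unlabelled as bs c₁ c₂ cs inc h bs>c₂ with Linked⇒Sorted inc
... | s@((c₁<c₂ ∷ _) ∷ _)
      with TwoSmallest.paths-keep-unlabelled c₁ c₂ c₁<c₂ as bs (c₁ ∷ c₂ ∷ cs) [] s h bs>c₂
             (unlabelled refl) (unlabelled refl)
...   | unlabelled l₁ , unlabelled l₂ = l₁ , l₂

two-smallest-unlabelled⇒Hall : ∀ as bs c₁ c₂ cs → Linked _<_ (c₁ ∷ c₂ ∷ cs) → All (_≢ c₂) bs →
  labelOf (runPaths bs (c₁ ∷ c₂ ∷ cs) [] as) c₁ ≡ 3 → labelOf (runPaths bs (c₁ ∷ c₂ ∷ cs) [] as) c₂ ≡ 3 →
  Hall bs (c₁ ∷ c₂ ∷ cs) × All (c₂ <_) bs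
two-smallest-unlabelled⇒Hall as bs c₁ c₂ cs inc bs≢c₂ l₁ l₂ with Linked⇒Sorted inc
... | s@((c₁<c₂ ∷ _) ∷ c₂<cs ∷ _)
      with TwoSmallest.unlabelled-paths⇒Hall c₁ c₂ c₁<c₂ as bs (c₁ ∷ c₂ ∷ cs) [] s
             (inj₁ refl ∷ inj₂ (inj₁ refl) ∷ All.map (λ c₂<c → inj₂ (inj₂ c₂<c)) c₂<cs)
             (λ _ → here refl) (λ _ → there (here refl)) bs≢c₂ (unlabelled l₁) (unlabelled l₂)
...   | _ , _ , h , bs>c₂ = h , bs>c₂

module _ {A : Set} where

  All-reverse⁺ : ∀ {P : A → Set} {xs} → All P xs → All P (reverse xs)
  All-reverse⁺ [] = []
  All-reverse⁺ {P} {x ∷ xs} (p ∷ ps) = subst (All P) (sym (unfold-reverse x xs)) (AllP.∷ʳ⁺ (All-reverse⁺ ps) p)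

  AllPairs-reverse⁺ : ∀ {R : A → A → Set} {xs} → AllPairs R xs → AllPairs (flip R) (reverse xs)
  AllPairs-reverse⁺ [] = []
  AllPairs-reverse⁺ {R} {x ∷ xs} (p ∷ ps) = subst (AllPairs (flip R)) (sym (unfold-reverse x xs))
    (AllPairsP.++⁺ (AllPairs-reverse⁺ ps) ([] ∷ []) (All.map (λ q → q ∷ []) (All-reverse⁺ p)))

ColumnStrict : List ℕ → List ℕ → Set
ColumnStrict Bs Cs = All (λ p → proj₁ p < proj₂ p) (zip Bs Cs)

count≥-all-below : ∀ {v Bs} → All (_< v) Bs → count≥ v Bs ≡ 0
count≥-all-below Bs<v = count-none (_ ≤?_) (All.map (λ w<v v≤w → <⇒≱ w<v v≤w) Bs<v)

Hall⇒column-strict : ∀ Bs Cs → Descending Bs → Descending Cs → Hall Bs Cs → length Bs ≤ length Cs × ColumnStrict Bs Cs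
Hall⇒column-strict [] Cs _ _ _ = z≤n , []
Hall⇒column-strict (x ∷ Bs) [] _ _ h = ⊥-elim (Hall-no-wrap h (here refl) [])
Hall⇒column-strict (x ∷ Bs) (y ∷ Cs) (Bs<x ∷ dB) (Cs<y ∷ dC) h =
  s≤s (proj₁ rest) , x<y ∷ proj₂ rest
  where
  x<y : x < y
  x<y with count-pos⁻ (x <?_) (y ∷ Cs) (≤-trans (count-pos (x ≤?_) (here refl) ≤-refl) (h x))
  ... | _ , here refl , x<w = x<w
  ... | _ , there w∈Cs , x<w = <-trans x<w (All.lookup Cs<y w∈Cs)
  hall : Hall Bs Cs
  hall v with v ≤? x
  ... | yes v≤x = s≤s⁻¹ (subst₂ _≤_ (count-removal-yes (v ≤?_) rhere v≤x)
                                    (count-removal-yes (v <?_) rhere (≤-<-trans v≤x x<y)) (h v))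
  ... | no v≰x = ≤-trans (≤-reflexive (count≥-all-below (All.map (λ w<x → <-trans w<x (≰⇒> v≰x)) Bs<x))) z≤n
  rest : length Bs ≤ length Cs × ColumnStrict Bs Cs
  rest = Hall⇒column-strict Bs Cs dB dC hall

column-strict⇒Hall : ∀ Bs Cs → Descending Bs → length Bs ≤ length Cs → ColumnStrict Bs Cs → Hall Bs Cs
column-strict⇒Hall [] Cs _ _ _ v = z≤n
column-strict⇒Hall (x ∷ Bs) (y ∷ Cs) (Bs<x ∷ dB) (s≤s len≤) (x<y ∷ cs) v with v ≤? x
... | yes v≤x = subst₂ _≤_ (sym (count-removal-yes (v ≤?_) rhere v≤x))
                          (sym (count-removal-yes (v <?_) rhere (≤-<-trans v≤x x<y)))
                          (s≤s (column-strict⇒Hall Bs Cs dB len≤ cs v))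
... | no v≰x = ≤-trans (≤-reflexive (count≥-all-below (≰⇒> v≰x ∷ All.map (λ w<x → <-trans w<x (≰⇒> v≰x)) Bs<x))) z≤n

Hall-reverse⁺ : ∀ Bs Cs → Hall Bs Cs → Hall (reverse Bs) (reverse Cs)
Hall-reverse⁺ Bs Cs h v = subst₂ _≤_ (sym (count-reverse (v ≤?_) Bs)) (sym (count-reverse (v <?_) Cs)) (h v)

Hall-reverse⁻ : ∀ Bs Cs → Hall (reverse Bs) (reverse Cs) → Hall Bs Cs
Hall-reverse⁻ Bs Cs h v = subst₂ _≤_ (count-reverse (v ≤?_) Bs) (count-reverse (v <?_) Cs) (h v)

Hall-drop-two-smallest : ∀ Bs c₁ c₂ Cs → Sorted (c₁ ∷ c₂ ∷ Cs) → All (c₂ <_) Bs → Hall Bs (c₁ ∷ c₂ ∷ Cs) → Hall Bs Cs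
Hall-drop-two-smallest Bs c₁ c₂ Cs ((c₁<c₂ ∷ _) ∷ _) Bs>c₂ h = hall
  where
  above-c₂ : ∀ v → c₂ < v → count≥ v Bs ≤ count> v Cs
  above-c₂ v c₂<v = subst (count≥ v Bs ≤_)
    (trans (count-removal-no (v <?_) rhere (λ v<c₁ → <-asym (<-trans c₁<c₂ c₂<v) v<c₁))
           (count-removal-no (v <?_) rhere (λ v<c₂ → <-asym c₂<v v<c₂))) (h v)
  hall : Hall Bs Cs
  hall v with c₂ <? v
  ... | yes c₂<v = above-c₂ v c₂<v
  ... | no c₂≮v = begin
      count≥ v Bs        ≤⟨ length-filter (v ≤?_) Bs ⟩
      length Bs          ≡⟨ sym (count-all (suc c₂ ≤?_) Bs>c₂) ⟩
      count≥ (suc c₂) Bs ≤⟨ above-c₂ (suc c₂) ≤-refl ⟩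
      count> (suc c₂) Cs ≤⟨ count-mono (suc c₂ <?_) (v <?_) {Cs} (All.tabulate λ _ → <-trans (s≤s (≮⇒≥ c₂≮v))) ⟩
      count> v Cs        ∎
    where open ≤-Reasoning

Hall-add-two : ∀ Bs c₁ c₂ Cs → Hall Bs Cs → Hall Bs (c₁ ∷ c₂ ∷ Cs)
Hall-add-two Bs c₁ c₂ Cs h v =
  ≤-trans (h v) (≤-trans (count-removal-≤ (v <?_) {c₂} {c₂ ∷ Cs} rhere) (count-removal-≤ (v <?_) {c₁} {c₁ ∷ c₂ ∷ Cs} rhere))

Good-intro : ∀ {s t m} (a : Vec ℕ s) (b : Vec ℕ (s + t)) (c₁ c₂ : ℕ) (cr : Vec ℕ m) {bs cs} →
  toList b ≡ bs → toList cr ≡ cs →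
  Linked _<_ (toList a) → Linked _<_ bs → Linked _<_ (c₁ ∷ c₂ ∷ cs) →
  ExactlyOnce (bigN s t (suc (suc m))) (toList a ++ bs ++ c₁ ∷ c₂ ∷ cs) →
  last (c₁ ∷ c₂ ∷ cs) ≡ just (bigN s t (suc (suc m))) →
  Hall bs (c₁ ∷ c₂ ∷ cs) → All (c₂ <_) bs → Good 3 3 s t (suc (suc m)) (a , b , c₁ ∷ᵥ c₂ ∷ᵥ cr)
Good-intro a b c₁ c₂ cr refl refl a-inc b-inc c-inc once last≡N hall b>c₂
  with Hall⇒two-smallest-unlabelled (toList a) (toList b) c₁ c₂ (toList cr) c-inc hall b>c₂
... | ω₁≡3 , ω₂≡3 = (a-inc , b-inc , c-inc , once) , last≡N , cong₂ (λ x y → x ∷ y ∷ []) ω₁≡3 ω₂≡3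

InRange : ℕ → ℕ → Set
InRange N x = 1 ≤ x × x ≤ N

range-∈⁺ : ∀ {N x} → InRange N x → x ∈ range N
range-∈⁺ {N} {suc x} (_ , x≤N) = ∈-applyUpTo⁺ suc x≤N

range-∈⁻ : ∀ {N x} → x ∈ range N → InRange N x
range-∈⁻ x∈ with ∈-applyUpTo⁻ suc x∈
... | _ , i<N , refl = s≤s z≤n , i<N

range-Unique : ∀ N → Unique (range N)
range-Unique N = UniqueP.applyUpTo⁺₁ suc N (λ i<j _ eq → <-irrefl (suc-injective eq) i<j)

range-Sorted : ∀ N → Sorted (range N)
range-Sorted N = AllPairsP.applyUpTo⁺₁ suc N (λ i<j _ → s≤s i<j)

module _ {X Y Z : Set} (g : X → Y → Z) where

  ∈-pairs⁺ : ∀ {x y xs ys} → x ∈ xs → y ∈ ys → g x y ∈ concatMap (λ x → map (g x) ys) xs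
  ∈-pairs⁺ {x} {y} {xs} {ys} x∈ y∈ =
    ∈-concatMap⁺ (λ x → map (g x) ys) (Any.map (λ { refl → ∈-map⁺ (g x) y∈ }) x∈)

  ∈-pairs⁻ : ∀ {z xs ys} → z ∈ concatMap (λ x → map (g x) ys) xs →
             ∃ λ x → ∃ λ y → x ∈ xs × y ∈ ys × z ≡ g x y
  ∈-pairs⁻ {z} {x ∷ xs} {ys} z∈ with ∈-++⁻ (map (g x) ys) z∈
  ... | inj₁ p = let (y , y∈ , eq) = ∈-map⁻ (g x) p in x , y , here refl , y∈ , eq
  ... | inj₂ p = let (x' , y , x∈ , y∈ , eq) = ∈-pairs⁻ {xs = xs} p in x' , y , there x∈ , y∈ , eq

  Unique-pairs⁺ : ∀ (π₁ : Z → X) (π₂ : Z → Y) → (∀ x y → π₁ (g x y) ≡ x) → (∀ x y → π₂ (g x y) ≡ y) →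
                  ∀ {xs ys} → Unique xs → Unique ys → Unique (concatMap (λ x → map (g x) ys) xs)
  Unique-pairs⁺ π₁ π₂ π₁-g π₂-g {xs} {ys} ux uy =
    Unique-concatMap⁺ (λ x → map (g x) ys) ux (λ x → Unique-map⁺-retract (g x) π₂ uy (λ _ → π₂-g x _))
      λ {x} {x'} z∈ z∈' → let (y , _ , eq) = ∈-map⁻ (g x) z∈ ; (y' , _ , eq') = ∈-map⁻ (g x') z∈'
                          in trans (sym (π₁-g x y)) (trans (cong π₁ (trans (sym eq) eq')) (π₁-g x' y'))

allVecs-∈⁺ : ∀ N {k} (v : Vec ℕ k) → All (InRange N) (toList v) → v ∈ allVecs N k
allVecs-∈⁺ N []ᵥ [] = here refl
allVecs-∈⁺ N (x ∷ᵥ v) (x-in ∷ v-in) = ∈-pairs⁺ _∷ᵥ_ (range-∈⁺ x-in) (allVecs-∈⁺ N v v-in)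

allVecs-∈⁻ : ∀ N {k} (v : Vec ℕ k) → v ∈ allVecs N k → All (InRange N) (toList v)
allVecs-∈⁻ N []ᵥ _ = []
allVecs-∈⁻ N {suc k} (x ∷ᵥ v) v∈ with ∈-pairs⁻ _∷ᵥ_ {xs = range N} v∈
... | _ , _ , x∈ , v∈' , eq with Vecₚ.∷-injective eq
...   | refl , refl = range-∈⁻ x∈ ∷ allVecs-∈⁻ N v v∈'

allVecs-Unique : ∀ N k → Unique (allVecs N k)
allVecs-Unique N zero = [] ∷ []
allVecs-Unique N (suc k) =
  Unique-pairs⁺ _∷ᵥ_ Vec.head Vec.tail (λ _ _ → refl) (λ _ _ → refl) (range-Unique N) (allVecs-Unique N k)

allTriples-∈⁺ : ∀ s t n (a : Vec ℕ s) (b : Vec ℕ (s + t)) (c : Vec ℕ n) →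
  a ∈ allVecs (bigN s t n) s → b ∈ allVecs (bigN s t n) (s + t) → c ∈ allVecs (bigN s t n) n →
  (a , b , c) ∈ allTriples s t n
allTriples-∈⁺ s t n a b c a∈ b∈ c∈ =
  ∈-concatMap⁺ _ (Any.map (λ { refl → ∈-pairs⁺ (λ b c → a , b , c) b∈ c∈ }) a∈)

allTriples-Unique : ∀ s t n → Unique (allTriples s t n)
allTriples-Unique s t n =
  Unique-concatMap⁺ _ (allVecs-Unique N s)
    (λ a → Unique-pairs⁺ (λ b c → a , b , c) (λ q → proj₁ (proj₂ q)) (λ q → proj₂ (proj₂ q))
             (λ _ _ → refl) (λ _ _ → refl) (allVecs-Unique N (s + t)) (allVecs-Unique N n))
    λ {a} {a'} q∈ q∈' → trans (sym (row1-of a q∈)) (row1-of a' q∈')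
  where
  N = bigN s t n
  row1-of : ∀ a {q} → q ∈ concatMap (λ b → map (λ c → a , b , c) (allVecs N n)) (allVecs N (s + t)) → proj₁ q ≡ a
  row1-of a q∈ with ∈-pairs⁻ (λ b c → a , b , c) {xs = allVecs N (s + t)} q∈
  ... | _ , _ , _ , _ , refl = refl

increasingVecs : (d lo k : ℕ) → List (Vec ℕ k)
increasingVecs d lo zero = []ᵥ ∷ []
increasingVecs zero lo (suc k) = []
increasingVecs (suc d) lo (suc k) =
  map (lo ∷ᵥ_) (increasingVecs d (suc lo) k) ++ increasingVecs d (suc lo) (suc k)

length-increasingVecs : ∀ d lo k → length (increasingVecs d lo k) ≡ d C k
length-increasingVecs d lo zero = refl
length-increasingVecs zero lo (suc k) = refl
length-increasingVecs (suc d) lo (suc k) = begin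
  length (map (lo ∷ᵥ_) (increasingVecs d (suc lo) k) ++ increasingVecs d (suc lo) (suc k))
    ≡⟨ length-++ (map (lo ∷ᵥ_) (increasingVecs d (suc lo) k)) ⟩
  length (map (lo ∷ᵥ_) (increasingVecs d (suc lo) k)) + length (increasingVecs d (suc lo) (suc k))
    ≡⟨ cong₂ _+_ (trans (length-map _ (increasingVecs d (suc lo) k)) (length-increasingVecs d (suc lo) k))
                 (length-increasingVecs d (suc lo) (suc k)) ⟩
  d C k + d C suc k
    ≡⟨ nCk+nC[k+1]≡[n+1]C[k+1] d k ⟩
  suc d C suc k ∎
  where open ≡-Reasoning

+suc⇒suc+ : ∀ {x} lo d → x < lo + suc d → x < suc lo + d
+suc⇒suc+ lo d x< = <-≤-trans x< (≤-reflexive (+-suc lo d))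

suc+⇒+suc : ∀ {x} lo d → x < suc lo + d → x < lo + suc d
suc+⇒+suc lo d x< = <-≤-trans x< (≤-reflexive (sym (+-suc lo d)))

IncreasingIn : ℕ → ℕ → List ℕ → Set
IncreasingIn lo d xs = Sorted xs × All (λ x → lo ≤ x × x < lo + d) xs

∈-increasingVecs⁻ : ∀ d lo {k} (v : Vec ℕ k) → v ∈ increasingVecs d lo k → IncreasingIn lo d (toList v)
∈-increasingVecs⁻ d lo {zero} []ᵥ _ = [] , []
∈-increasingVecs⁻ (suc d) lo {suc k} v v∈ with ∈-++⁻ (map (lo ∷ᵥ_) (increasingVecs d (suc lo) k)) v∈
... | inj₁ v∈₁ with ∈-map⁻ (lo ∷ᵥ_) v∈₁
...   | w , w∈ , refl with ∈-increasingVecs⁻ d (suc lo) w w∈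
...     | sw , bw = All.map proj₁ bw ∷ sw ,
                    (≤-refl , m<m+n lo (s≤s z≤n)) ∷
                    All.map (λ (lo<x , x<) → <⇒≤ lo<x , suc+⇒+suc lo d x<) bw
∈-increasingVecs⁻ (suc d) lo {suc k} v v∈ | inj₂ v∈₂ with ∈-increasingVecs⁻ d (suc lo) v v∈₂
... | sv , bv = sv , All.map (λ (lo<x , x<) → <⇒≤ lo<x , suc+⇒+suc lo d x<) bv

∈-increasingVecs⁺ : ∀ d lo {k} (v : Vec ℕ k) → IncreasingIn lo d (toList v) → v ∈ increasingVecs d lo k
∈-increasingVecs⁺ d lo {zero} []ᵥ _ = here refl
∈-increasingVecs⁺ zero lo {suc k} (x ∷ᵥ v) (_ , (lo≤x , x<lo+0) ∷ _) =
  ⊥-elim (<⇒≱ x<lo+0 (subst (_≤ x) (sym (+-identityʳ lo)) lo≤x))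
∈-increasingVecs⁺ (suc d) lo {suc k} (x ∷ᵥ v) (x<v ∷ sv , (lo≤x , x<) ∷ bv) with m≤n⇒m<n∨m≡n lo≤x
... | inj₂ refl = ∈-++⁺ˡ (∈-map⁺ (lo ∷ᵥ_) (∈-increasingVecs⁺ d (suc lo) v (sv ,
        All.zipWith (λ (lo<y , _ , y<) → lo<y , +suc⇒suc+ lo d y<) (x<v , bv))))
... | inj₁ lo<x = ∈-++⁺ʳ (map (lo ∷ᵥ_) (increasingVecs d (suc lo) k)) (∈-increasingVecs⁺ d (suc lo) (x ∷ᵥ v) (x<v ∷ sv ,
        (lo<x , +suc⇒suc+ lo d x<) ∷
        All.zipWith (λ (x<y , _ , y<) → <-trans lo<x x<y , +suc⇒suc+ lo d y<) (x<v , bv)))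

increasingVecs-Unique : ∀ d lo k → Unique (increasingVecs d lo k)
increasingVecs-Unique d lo zero = [] ∷ []
increasingVecs-Unique zero lo (suc k) = []
increasingVecs-Unique (suc d) lo (suc k) =
  UniqueP.++⁺ (Unique-map⁺-retract (lo ∷ᵥ_) Vec.tail (increasingVecs-Unique d (suc lo) k) (λ _ → refl))
              (increasingVecs-Unique d (suc lo) (suc k))
              (λ (v∈₁ , v∈₂) → starts-with-lo v∈₁ v∈₂)
  where
  starts-with-lo : ∀ {v} → v ∈ map (lo ∷ᵥ_) (increasingVecs d (suc lo) k) → v ∉ increasingVecs d (suc lo) (suc k)
  starts-with-lo v∈₁ v∈₂ with ∈-map⁻ (lo ∷ᵥ_) v∈₁
  ... | w , _ , refl with ∈-increasingVecs⁻ d (suc lo) (lo ∷ᵥ w) v∈₂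
  ...   | _ , (lo<lo , _) ∷ _ = <-irrefl refl lo<lo

increasing? : ∀ {k} (v : Vec ℕ k) → Dec (Linked _<_ (toList v))
increasing? v = linked? _<?_ (toList v)

count-increasing-allVecs : ∀ N k → count increasing? (allVecs N k) ≡ N C k
count-increasing-allVecs N k = begin
  count increasing? (allVecs N k)
    ≡⟨ count-bijection increasing? (λ _ → yes tt) (allVecs N k) (increasingVecs N 1 k)
         (allVecs-Unique N k) (increasingVecs-Unique N 1 k) id id
         (λ {v} v∈ inc → ∈-increasingVecs⁺ N 1 v (Linked⇒Sorted inc ,
                           All.map (λ (1≤x , x≤N) → 1≤x , s≤s x≤N) (allVecs-∈⁻ N v v∈)) , tt , refl)
         (λ {v} v∈ _ → let (sv , bv) = ∈-increasingVecs⁻ N 1 v v∈ in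
                       allVecs-∈⁺ N v (All.map (λ (1≤x , x<) → 1≤x , s≤s⁻¹ x<) bv) ,
                       LinkedP.AllPairs⇒Linked sv , refl) ⟩
  count (λ _ → yes tt) (increasingVecs N 1 k)
    ≡⟨ count-all (λ _ → yes tt) {increasingVecs N 1 k} (All.tabulate (λ _ → tt)) ⟩
  length (increasingVecs N 1 k)
    ≡⟨ length-increasingVecs N 1 k ⟩
  N C k ∎
  where open ≡-Reasoning

module _ {X Y : Set} {P : X → Set} {Q : Y → Set} (P? : Decidable P) (Q? : Decidable Q) where

  pair? : Decidable (λ (p : X × Y) → P (proj₁ p) × Q (proj₂ p))
  pair? p = P? (proj₁ p) ×-dec Q? (proj₂ p)

  count-pairs : ∀ xs ys → count pair? (concatMap (λ x → map (x ,_) ys) xs) ≡ count P? xs * count Q? ys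
  count-pairs [] ys = refl
  count-pairs (x ∷ xs) ys with P? x
  ... | yes px = trans (count-++ pair? (map (x ,_) ys) _) (cong₂ _+_ (row px ys) (count-pairs xs ys))
    where
    row : P x → ∀ ys → count pair? (map (x ,_) ys) ≡ count Q? ys
    row px [] = refl
    row px (y ∷ ys) with P? x | Q? y
    ... | yes _ | yes _ = cong suc (row px ys)
    ... | yes _ | no _ = row px ys
    ... | no ¬px | _ = ⊥-elim (¬px px)
  ... | no ¬px = trans (count-++ pair? (map (x ,_) ys) _)
                   (cong₂ _+_ (count-none pair? {map (x ,_) ys} (AllP.map⁺ (All.tabulate (λ _ (px , _) → ¬px px))))
                              (count-pairs xs ys))

nth : List ℕ → ℕ → ℕ
nth [] _ = 0
nth (x ∷ xs) zero = x
nth (x ∷ xs) (suc i) = nth xs i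

nth-∈ : ∀ xs i → i < length xs → nth xs i ∈ xs
nth-∈ (x ∷ xs) zero _ = here refl
nth-∈ (x ∷ xs) (suc i) (s≤s i<) = there (nth-∈ xs i i<)

∈⇒nth : ∀ {xs v} → v ∈ xs → ∃ λ i → i < length xs × nth xs i ≡ v
∈⇒nth (here refl) = 0 , s≤s z≤n , refl
∈⇒nth (there v∈) with ∈⇒nth v∈
... | i , i< , eq = suc i , s≤s i< , eq

count≥-nth : ∀ xs i → Descending xs → i < length xs → count≥ (nth xs i) xs ≡ suc i
count≥-nth (x ∷ xs) zero (xs<x ∷ _) _ =
  trans (count-removal-yes (x ≤?_) rhere ≤-refl) (cong suc (count≥-all-below xs<x))
count≥-nth (x ∷ xs) (suc i) (xs<x ∷ dxs) (s≤s i<) =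
  trans (count-removal-yes (nth xs i ≤?_) rhere (<⇒≤ (All.lookup xs<x (nth-∈ xs i i<)))) (cong suc (count≥-nth xs i dxs i<))

-- The entries of {1,…,N} ∖ A listed in decreasing order; rank v is the position of v in that list
-- (counted from 1), unrank p the entry at position p.
module Complement (N : ℕ) (A : List ℕ) where

  desc : List ℕ
  desc = reverse (filter (_∉? A) (range N))

  rank : ℕ → ℕ
  rank v = count≥ v desc

  unrank : ℕ → ℕ
  unrank p = nth desc (p ∸ 1)

  ∈-desc⁺ : ∀ {v} → InRange N v → v ∉ A → v ∈ desc
  ∈-desc⁺ v-in v∉A = AnyP.reverse⁺ (∈-filter⁺ (_∉? A) (range-∈⁺ v-in) v∉A)

  ∈-desc⁻ : ∀ {v} → v ∈ desc → InRange N v × v ∉ A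
  ∈-desc⁻ v∈ with ∈-filter⁻ (_∉? A) (AnyP.reverse⁻ v∈)
  ... | v∈range , v∉A = range-∈⁻ v∈range , v∉A

  desc-Descending : Descending desc
  desc-Descending = AllPairs-reverse⁺ (AllPairsP.filter⁺ (_∉? A) (range-Sorted N))

  length-desc : Unique A → All (InRange N) A → length desc + length A ≡ N
  length-desc uA A-in = begin
    length desc + length A
      ≡⟨ cong₂ _+_ (length-reverse (filter (_∉? A) (range N))) length-A ⟩
    count (_∉? A) (range N) + count (_∈? A) (range N)
      ≡⟨ count-split (range N) ⟩
    length (range N)
      ≡⟨ length-applyUpTo suc N ⟩
    N ∎
    where
    open ≡-Reasoning
    count-split : ∀ xs → count (_∉? A) xs + count (_∈? A) xs ≡ length xs
    count-split [] = refl
    count-split (x ∷ xs) with x ∈? A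
    ... | yes _ = trans (+-suc _ _) (cong suc (count-split xs))
    ... | no _ = cong suc (count-split xs)
    length-A : length A ≡ count (_∈? A) (range N)
    length-A = trans (sym (count-all (λ _ → yes tt) {A} (All.tabulate (λ _ → tt))))
      (count-bijection (λ _ → yes tt) (_∈? A) A (range N) uA (range-Unique N) id id
         (λ x∈ _ → range-∈⁺ (All.lookup A-in x∈) , x∈ , refl)
         (λ _ x∈ → x∈ , tt , refl))

  rank-pos : ∀ {v} → v ∈ desc → 1 ≤ rank v
  rank-pos v∈ = count-pos (_ ≤?_) v∈ ≤-refl

  rank≤length : ∀ v → rank v ≤ length desc
  rank≤length v = length-filter (v ≤?_) desc

  unrank-rank : ∀ {v} → v ∈ desc → unrank (rank v) ≡ v
  unrank-rank v∈ with ∈⇒nth v∈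
  ... | i , i< , refl = cong (λ j → nth desc (j ∸ 1)) (count≥-nth desc i desc-Descending i<)

  rank-unrank : ∀ {p} → 1 ≤ p → p ≤ length desc → rank (unrank p) ≡ p
  rank-unrank {suc p} _ p< = count≥-nth desc p desc-Descending p<

  unrank-∈ : ∀ {p} → 1 ≤ p → p ≤ length desc → unrank p ∈ desc
  unrank-∈ {suc p} _ p< = nth-∈ desc p p<

  rank-injective : ∀ {v w} → v ∈ desc → w ∈ desc → rank v ≡ rank w → v ≡ w
  rank-injective v∈ w∈ eq = trans (sym (unrank-rank v∈)) (trans (cong unrank eq) (unrank-rank w∈))

  rank-antitone : ∀ {v w} → v ∈ desc → w ∈ desc → v < w → rank w < rank v
  rank-antitone v∈ w∈ v<w =
    ≤∧≢⇒< (count-mono (_ ≤?_) (_ ≤?_) {desc} (All.tabulate λ _ → ≤-trans (<⇒≤ v<w)))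
           (λ eq → <-irrefl (rank-injective v∈ w∈ (sym eq)) v<w)

  unrank-antitone : ∀ {p q} → 1 ≤ p → q ≤ length desc → p < q → unrank q < unrank p
  unrank-antitone {p} {q} 1≤p q≤ p<q = ≰⇒> unrank-p≰unrank-q
    where
    p≤ : p ≤ length desc
    p≤ = ≤-trans (<⇒≤ p<q) q≤
    1≤q : 1 ≤ q
    1≤q = ≤-trans 1≤p (<⇒≤ p<q)
    unrank-p≰unrank-q : ¬ unrank p ≤ unrank q
    unrank-p≰unrank-q le with m≤n⇒m<n∨m≡n le
    ... | inj₁ lt = <-asym p<q (subst₂ _<_ (rank-unrank 1≤q q≤) (rank-unrank 1≤p p≤)
                                          (rank-antitone (unrank-∈ 1≤p p≤) (unrank-∈ 1≤q q≤) lt))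
    ... | inj₂ eq = <-irrefl (trans (sym (rank-unrank 1≤p p≤)) (trans (cong rank eq) (rank-unrank 1≤q q≤))) p<q

Sorted⇒Unique : ∀ {xs} → Sorted xs → Unique xs
Sorted⇒Unique = AllPairs.map (λ x<y x≡y → <-irrefl x≡y x<y)

occ-∉ : ∀ {k} xs → k ∉ xs → occ k xs ≡ 0
occ-∉ xs k∉ = count-none (_≟ _) (All.tabulate λ x∈ x≡k → k∉ (subst (_∈ xs) x≡k x∈))

occ-Unique-∈ : ∀ {k} xs → Unique xs → k ∈ xs → occ k xs ≡ 1
occ-Unique-∈ {k} xs u k∈ with ∈⇒removal k∈
... | xs' , r = trans (count-removal-yes (_≟ k) r refl) (cong suc (occ-∉ xs' (removed-∉ r u)))
  where
  removed-∉ : ∀ {xs xs'} → Removal k xs xs' → Unique xs → k ∉ xs'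
  removed-∉ rhere (k∉ ∷ _) k∈' = All.lookup k∉ k∈' refl
  removed-∉ (rthere r) (y∉ ∷ _) (here refl) = All.lookup y∉ (removed-∈ r) refl
  removed-∉ (rthere r) (_ ∷ u) (there k∈') = removed-∉ r u k∈'

occ-pos⇒∈ : ∀ {k} xs → 1 ≤ occ k xs → k ∈ xs
occ-pos⇒∈ xs pos with count-pos⁻ (_≟ _) xs pos
... | _ , x∈ , refl = x∈

occ-map : ∀ (g : ℕ → ℕ) x xs → (∀ {y} → y ∈ xs → g y ≡ g x → y ≡ x) → occ (g x) (map g xs) ≡ occ x xs
occ-map g x [] _ = refl
occ-map g x (y ∷ xs) inj with y ≟ x
... | yes refl = trans (count-removal-yes (_≟ g x) rhere refl)
                       (trans (cong suc (occ-map g x xs (inj ∘ there))) (sym (count-removal-yes (_≟ x) rhere refl)))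
... | no y≢x = trans (count-removal-no (_≟ g x) rhere (y≢x ∘ inj (here refl)))
                     (trans (occ-map g x xs (inj ∘ there)) (sym (count-removal-no (_≟ x) rhere y≢x)))

occ-++₃ : ∀ k (X Y Z : List ℕ) → occ k (X ++ Y ++ Z) ≡ occ k X + (occ k Y + occ k Z)
occ-++₃ k X Y Z = trans (count-++ (_≟ k) X (Y ++ Z)) (cong (occ k X +_) (count-++ (_≟ k) Y Z))

toList-reverse-map : ∀ {k} (g : ℕ → ℕ) (v : Vec ℕ k) → toList (Vec.reverse (Vec.map g v)) ≡ reverse (map g (toList v))
toList-reverse-map g v = trans (Vecₚ.toList-reverse (Vec.map g v)) (cong reverse (Vecₚ.toList-map g v))

last-∈ : ∀ {x : ℕ} xs → last xs ≡ just x → x ∈ xs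
last-∈ (y ∷ []) refl = here refl
last-∈ (y ∷ z ∷ xs) eq = there (last-∈ (z ∷ xs) eq)

last-∷ʳ : ∀ (u : ℕ) xs x → last (u ∷ (xs ∷ʳ x)) ≡ just x
last-∷ʳ u [] x = refl
last-∷ʳ u (y ∷ xs) x = last-∷ʳ y xs x

module AntitoneMap (g : ℕ → ℕ) (P : ℕ → Set) (antitone : ∀ {x y} → P x → P y → x < y → g y < g x) where

  map-antitone-Descending : ∀ {xs} → All P xs → Sorted xs → Descending (map g xs)
  map-antitone-Descending [] [] = []
  map-antitone-Descending (px ∷ pxs) (x<xs ∷ sxs) =
    AllP.map⁺ (All.zipWith (λ (x<y , py) → antitone px py x<y) (x<xs , pxs)) ∷ map-antitone-Descending pxs sxs

  map-antitone-ColumnStrict : ∀ {xs ys} → All P xs → All P ys → ColumnStrict xs ys → ColumnStrict (map g ys) (map g xs)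
  map-antitone-ColumnStrict {[]} {ys} _ _ _ = zip-[] (map g ys)
    where
    zip-[] : ∀ zs → ColumnStrict zs []
    zip-[] [] = []
    zip-[] (_ ∷ _) = []
  map-antitone-ColumnStrict {_ ∷ _} {[]} _ _ _ = []
  map-antitone-ColumnStrict {_ ∷ _} {_ ∷ _} (px ∷ pxs) (py ∷ pys) (x<y ∷ cs) =
    antitone px py x<y ∷ map-antitone-ColumnStrict pxs pys cs

  reverse-map-antitone-Sorted : ∀ {xs} → All P xs → Sorted xs → Sorted (reverse (map g xs))
  reverse-map-antitone-Sorted pxs sxs = AllPairs-reverse⁺ (map-antitone-Descending pxs sxs)

ColumnStrict-head : ∀ {x xs ys} → ColumnStrict (x ∷ xs) ys → Sorted ys → All (x <_) ys
ColumnStrict-head {ys = []} _ _ = []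
ColumnStrict-head {ys = y ∷ _} (x<y ∷ _) (y<ys ∷ _) = x<y ∷ All.map (<-trans x<y) y<ys

tableau-corner : ∀ {x xs ys} → Sorted (x ∷ xs) → Sorted ys → ColumnStrict (x ∷ xs) ys → 1 ≤ x →
                 1 ∈ (x ∷ xs) ++ ys → x ≡ 1
tableau-corner _ _ _ _ (here 1≡x) = sym 1≡x
tableau-corner {xs = xs} (x<xs ∷ _) sys cols 1≤x (there 1∈) with ∈-++⁻ xs 1∈
... | inj₁ 1∈xs = ⊥-elim (<⇒≱ (All.lookup x<xs 1∈xs) 1≤x)
... | inj₂ 1∈ys = ⊥-elim (<⇒≱ (All.lookup (ColumnStrict-head cols sys) 1∈ys) 1≤x)

reverse-map-reverse-map : ∀ {k} (f g : ℕ → ℕ) (v : Vec ℕ k) → All (λ x → f (g x) ≡ x) (toList v) →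
  Vec.reverse (Vec.map f (Vec.reverse (Vec.map g v))) ≡ v
reverse-map-reverse-map f g v fg≡id = trans (sym (Vecₚ.cast-is-id refl _)) (Vecₚ.toList-injective refl _ _ (begin
  toList (Vec.reverse (Vec.map f (Vec.reverse (Vec.map g v))))
    ≡⟨ toList-reverse-map f (Vec.reverse (Vec.map g v)) ⟩
  reverse (map f (toList (Vec.reverse (Vec.map g v))))
    ≡⟨ cong (reverse ∘ map f) (toList-reverse-map g v) ⟩
  reverse (map f (reverse (map g (toList v))))
    ≡⟨ cong reverse (reverse-map f (map g (toList v))) ⟩
  reverse (reverse (map f (map g (toList v))))
    ≡⟨ reverse-involutive _ ⟩
  map f (map g (toList v))
    ≡⟨ sym (map-∘ (toList v)) ⟩
  map (f ∘ g) (toList v)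
    ≡⟨ map-id-local fg≡id ⟩
  toList v ∎))
  where open ≡-Reasoning

bigN≡ : ∀ s t m → suc (suc (m + (s + t))) + s ≡ bigN s t (suc (suc m))
bigN≡ = solve 3 (λ s t m → (con 2 :+ (m :+ (s :+ t))) :+ s := ((con 2 :+ m) :+ con 2 :* s) :+ t) refl
  where open +-*-Solver

module QueueTableauBijection (s t m : ℕ) where

  n N M : ℕ
  n = suc (suc m)
  N = bigN s t n
  M = m + (s + t)

  tableaux : List (Vec ℕ m × Vec ℕ (s + t))
  tableaux = concatMap (λ r → map (r ,_) (allVecs M (s + t))) (allVecs M m)

  candidates : List (Vec ℕ s × Vec ℕ m × Vec ℕ (s + t))
  candidates = concatMap (λ a → map (a ,_) tableaux) (allVecs (N ∸ 1) s)

  Admissible : Vec ℕ s × Vec ℕ m × Vec ℕ (s + t) → Set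
  Admissible x = Linked _<_ (toList (proj₁ x)) × IsSYT m (s + t) (proj₂ x)

  admissible? : ∀ x → Dec (Admissible x)
  admissible? x = increasing? (proj₁ x) ×-dec isSYT? m (s + t) (proj₂ x)

  rankₐ unrankₐ : Vec ℕ s → ℕ → ℕ
  rankₐ a = Complement.rank N (toList a)
  unrankₐ a = Complement.unrank N (toList a)

  toQueue : Vec ℕ s × Vec ℕ m × Vec ℕ (s + t) → Triple s t n
  toQueue (a , r , r') =
    a , Vec.reverse (Vec.map (unrankₐ a) r') ,
    unrankₐ a (suc (suc M)) ∷ᵥ unrankₐ a (suc M) ∷ᵥ Vec.reverse (Vec.map (unrankₐ a) r)

  toTableau : Triple s t n → Vec ℕ s × Vec ℕ m × Vec ℕ (s + t)
  toTableau (a , b , _ ∷ᵥ _ ∷ᵥ cs) = a , Vec.reverse (Vec.map (rankₐ a) cs) , Vec.reverse (Vec.map (rankₐ a) b)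

  module Row1 (a : Vec ℕ s) (a-Unique : Unique (toList a)) (a-in : All (InRange N) (toList a)) where
    open Complement N (toList a) public

    length-desc≡ : length desc ≡ suc (suc M)
    length-desc≡ = +-cancelʳ-≡ s (length desc) (suc (suc M))
      (trans (cong (length desc +_) (sym (Vecₚ.length-toList a)))
             (trans (length-desc a-Unique a-in) (sym (bigN≡ s t m))))

  module ToQueue (a : Vec ℕ s) (r : Vec ℕ m) (r' : Vec ℕ (s + t))
    (a-in : All (InRange (N ∸ 1)) (toList a)) (a-inc : Linked _<_ (toList a))
    (syt : IsSYT m (s + t) (r , r')) where

    as rs rs' : List ℕ
    as = toList a
    rs = toList r
    rs' = toList r'

    a-inN : All (InRange N) as
    a-inN = All.map (λ (1≤x , x≤) → 1≤x , m≤n⇒m≤1+n x≤) a-in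

    open Row1 a (Sorted⇒Unique (Linked⇒Sorted a-inc)) a-inN

    st≤m : s + t ≤ m
    st≤m = proj₁ syt
    rs-inc : Linked _<_ rs
    rs-inc = proj₁ (proj₂ syt)
    rs'-inc : Linked _<_ rs'
    rs'-inc = proj₁ (proj₂ (proj₂ syt))
    columns : ColumnStrict rs rs'
    columns = proj₁ (proj₂ (proj₂ (proj₂ syt)))
    syt-once : ExactlyOnce M (rs ++ rs')
    syt-once = proj₂ (proj₂ (proj₂ (proj₂ syt)))

    rs-in : All (InRange M) rs
    rs-in = proj₁ (AllP.++⁻ rs (proj₁ syt-once))
    rs'-in : All (InRange M) rs'
    rs'-in = proj₂ (AllP.++⁻ rs (proj₁ syt-once))

    ValidRank : ℕ → Set
    ValidRank p = 1 ≤ p × p ≤ length desc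

    InRange⇒ValidRank : ∀ {p} → InRange M p → ValidRank p
    InRange⇒ValidRank (1≤p , p≤M) = 1≤p , subst (_ ≤_) (sym length-desc≡) (≤-trans p≤M (≤-trans (n≤1+n M) (n≤1+n (suc M))))

    ValidRank-M+1 : ValidRank (suc M)
    ValidRank-M+1 = s≤s z≤n , subst (suc M ≤_) (sym length-desc≡) (n≤1+n (suc M))

    ValidRank-M+2 : ValidRank (suc (suc M))
    ValidRank-M+2 = s≤s z≤n , ≤-reflexive (sym length-desc≡)

    open AntitoneMap unrank ValidRank (λ vp vq p<q → unrank-antitone (proj₁ vp) (proj₂ vq) p<q)

    top : List ℕ
    top = suc M ∷ suc (suc M) ∷ []

    rs⁺ : List ℕ
    rs⁺ = rs ++ top

    rs⁺-valid : All ValidRank rs⁺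
    rs⁺-valid = AllP.++⁺ (All.map InRange⇒ValidRank rs-in) (ValidRank-M+1 ∷ ValidRank-M+2 ∷ [])

    rs⁺-Sorted : Sorted rs⁺
    rs⁺-Sorted = AllPairsP.++⁺ (Linked⇒Sorted rs-inc) ((n<1+n (suc M) ∷ []) ∷ [] ∷ [])
                   (All.map (λ (_ , x≤M) → s≤s x≤M ∷ m<n⇒m<1+n (s≤s x≤M) ∷ []) rs-in)

    bs cs₀ cs : List ℕ
    bs = reverse (map unrank rs')
    cs₀ = reverse (map unrank rs)
    cs = unrank (suc (suc M)) ∷ unrank (suc M) ∷ cs₀

    cs≡ : reverse (map unrank rs⁺) ≡ cs
    cs≡ = begin
      reverse (map unrank rs⁺)                     ≡⟨ cong reverse (map-++ unrank rs top) ⟩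
      reverse (map unrank rs ++ map unrank top)    ≡⟨ reverse-++ (map unrank rs) (map unrank top) ⟩
      reverse (map unrank top) ++ cs₀              ≡⟨⟩
      cs                                           ∎
      where open ≡-Reasoning

    bs-inc : Linked _<_ bs
    bs-inc = LinkedP.AllPairs⇒Linked (reverse-map-antitone-Sorted (All.map InRange⇒ValidRank rs'-in) (Linked⇒Sorted rs'-inc))

    cs-inc : Linked _<_ cs
    cs-inc = subst (Linked _<_) cs≡ (LinkedP.AllPairs⇒Linked (reverse-map-antitone-Sorted rs⁺-valid rs⁺-Sorted))

    ranks : List ℕ
    ranks = rs' ++ rs⁺

    ranks-valid : All ValidRank ranks
    ranks-valid = AllP.++⁺ (All.map InRange⇒ValidRank rs'-in) rs⁺-valid

    occ-rows-2-3 : ∀ k → occ k bs + occ k cs ≡ occ k (map unrank ranks)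
    occ-rows-2-3 k = begin
      occ k bs + occ k cs
        ≡⟨ cong₂ _+_ (count-reverse (_≟ k) (map unrank rs'))
                     (trans (cong (occ k) (sym cs≡)) (count-reverse (_≟ k) (map unrank rs⁺))) ⟩
      occ k (map unrank rs') + occ k (map unrank rs⁺)
        ≡⟨ sym (count-++ (_≟ k) (map unrank rs') (map unrank rs⁺)) ⟩
      occ k (map unrank rs' ++ map unrank rs⁺)
        ≡⟨ cong (occ k) (sym (map-++ unrank rs' rs⁺)) ⟩
      occ k (map unrank ranks) ∎
      where open ≡-Reasoning

    occ-ranks : ∀ p → ValidRank p → occ p ranks ≡ 1
    occ-ranks p (1≤p , p≤) with p ≤? M
    ... | yes p≤M = begin
          occ p ranks                          ≡⟨ occ-++₃ p rs' rs top ⟩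
          occ p rs' + (occ p rs + occ p top)   ≡⟨ cong (λ z → occ p rs' + (occ p rs + z)) (occ-∉ top p∉top) ⟩
          occ p rs' + (occ p rs + 0)           ≡⟨ cong (occ p rs' +_) (+-identityʳ (occ p rs)) ⟩
          occ p rs' + occ p rs                 ≡⟨ +-comm (occ p rs') (occ p rs) ⟩
          occ p rs + occ p rs'                 ≡⟨ sym (count-++ (_≟ p) rs rs') ⟩
          occ p (rs ++ rs')                    ≡⟨ All.lookup (proj₂ syt-once) (range-∈⁺ (1≤p , p≤M)) ⟩
          1                                    ∎
      where
      open ≡-Reasoning
      p∉top : p ∉ top
      p∉top (here p≡) = <-irrefl p≡ (s≤s p≤M)
      p∉top (there (here p≡)) = <-irrefl p≡ (m<n⇒m<1+n (s≤s p≤M))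
    ... | no p≰M = begin
          occ p ranks                          ≡⟨ occ-++₃ p rs' rs top ⟩
          occ p rs' + (occ p rs + occ p top)   ≡⟨ cong₂ (λ x y → x + (y + occ p top)) (above-M rs'-in) (above-M rs-in) ⟩
          occ p top                            ≡⟨ occ-Unique-∈ top (Sorted⇒Unique ((n<1+n (suc M) ∷ []) ∷ [] ∷ [])) p∈top ⟩
          1                                    ∎
      where
      open ≡-Reasoning
      above-M : ∀ {xs} → All (InRange M) xs → occ p xs ≡ 0
      above-M xs-in = occ-∉ _ (λ p∈ → p≰M (proj₂ (All.lookup xs-in p∈)))
      p∈top : p ∈ top
      p∈top with m≤n⇒m<n∨m≡n (subst (p ≤_) length-desc≡ p≤)
      ... | inj₂ p≡ = there (here p≡)
      ... | inj₁ p< = here (≤-antisym (s≤s⁻¹ p<) (≰⇒> p≰M))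

    unranks-∈-desc : ∀ {ps} → All ValidRank ps → All (_∈ desc) (map unrank ps)
    unranks-∈-desc ps-valid = AllP.map⁺ (All.map (λ (1≤p , p≤) → unrank-∈ 1≤p p≤) ps-valid)

    bs-∈-desc : All (_∈ desc) bs
    bs-∈-desc = All-reverse⁺ (unranks-∈-desc (All.map InRange⇒ValidRank rs'-in))

    cs-∈-desc : All (_∈ desc) cs
    cs-∈-desc = subst (All (_∈ desc)) cs≡ (All-reverse⁺ (unranks-∈-desc rs⁺-valid))

    exactlyOnce : ExactlyOnce N (as ++ bs ++ cs)
    exactlyOnce =
      AllP.++⁺ a-inN (AllP.++⁺ (All.map (proj₁ ∘ ∈-desc⁻) bs-∈-desc) (All.map (proj₁ ∘ ∈-desc⁻) cs-∈-desc)) ,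
      All.tabulate (λ {k} k∈ → trans (occ-++₃ k as bs cs) (trans (cong (occ k as +_) (occ-rows-2-3 k)) (once k k∈)))
      where
      once : ∀ k → k ∈ range N → occ k as + occ k (map unrank ranks) ≡ 1
      once k k∈ with k ∈? as
      ... | yes k∈as = cong₂ _+_ (occ-Unique-∈ as (Sorted⇒Unique (Linked⇒Sorted a-inc)) k∈as) (occ-∉ _ k∉ranks)
        where
        k∉ranks : k ∉ map unrank ranks
        k∉ranks k∈ranks = proj₂ (∈-desc⁻ (All.lookup (unranks-∈-desc ranks-valid) k∈ranks)) k∈as
      ... | no k∉as = cong₂ _+_ (occ-∉ as k∉as) (begin
          occ k (map unrank ranks)            ≡⟨ cong (λ z → occ z (map unrank ranks)) (sym (unrank-rank k∈desc)) ⟩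
          occ (unrank (rank k)) (map unrank ranks)
            ≡⟨ occ-map unrank (rank k) ranks (λ y∈ eq → trans (sym (rank-unrank-valid (All.lookup ranks-valid y∈)))
                                                               (trans (cong rank eq) (rank-unrank-valid rank-k-valid))) ⟩
          occ (rank k) ranks                  ≡⟨ occ-ranks (rank k) rank-k-valid ⟩
          1                                   ∎)
        where
        open ≡-Reasoning
        k∈desc : k ∈ desc
        k∈desc = ∈-desc⁺ (range-∈⁻ k∈) k∉as
        rank-k-valid : ValidRank (rank k)
        rank-k-valid = rank-pos k∈desc , rank≤length k
        rank-unrank-valid : ∀ {p} → ValidRank p → rank (unrank p) ≡ p
        rank-unrank-valid (1≤p , p≤) = rank-unrank 1≤p p≤

    N∈desc : N ∈ desc
    N∈desc = ∈-desc⁺ (s≤s z≤n , ≤-refl) (λ N∈as → 1+n≰n (proj₂ (All.lookup a-in N∈as)))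

    rank-N : rank N ≡ 1
    rank-N with ∈⇒removal N∈desc
    ... | desc' , r = trans (count-removal-yes (N ≤?_) r ≤-refl) (cong suc (count≥-all-below (All.tabulate below-N)))
      where
      below-N : ∀ {d} → d ∈ desc' → d < N
      below-N d∈ with removed-related r desc-Descending d∈
      ... | inj₁ d<N = d<N
      ... | inj₂ N<d = ⊥-elim (<⇒≱ N<d (proj₂ (proj₁ (∈-desc⁻ (removal-⊆ r d∈)))))

    unrank-1 : unrank 1 ≡ N
    unrank-1 = trans (cong unrank (sym rank-N)) (unrank-rank N∈desc)

    last-row3 : ∀ xs → rs ≡ xs → last (unrank (suc (suc M)) ∷ unrank (suc M) ∷ reverse (map unrank xs)) ≡ just N
    last-row3 [] rs≡[] = cong just (trans (cong (unrank ∘ suc) M≡0) unrank-1)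
      where
      m≡0 : m ≡ 0
      m≡0 = trans (sym (Vecₚ.length-toList r)) (cong length rs≡[])
      M≡0 : M ≡ 0
      M≡0 = trans (cong (_+ (s + t)) m≡0) (n≤0⇒n≡0 (subst (s + t ≤_) m≡0 st≤m))
    last-row3 (x ∷ xs) rs≡ = begin
      last (unrank (suc M) ∷ reverse (map unrank (x ∷ xs)))
        ≡⟨ cong (λ ys → last (unrank (suc M) ∷ ys)) (unfold-reverse (unrank x) (map unrank xs)) ⟩
      last (unrank (suc M) ∷ (reverse (map unrank xs) ∷ʳ unrank x))
        ≡⟨ last-∷ʳ (unrank (suc M)) (reverse (map unrank xs)) (unrank x) ⟩
      just (unrank x)
        ≡⟨ cong (just ∘ unrank) x≡1 ⟩
      just (unrank 1)
        ≡⟨ cong just unrank-1 ⟩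
      just N ∎
      where
      open ≡-Reasoning
      x-in : InRange M x
      x-in = All.head (subst (All (InRange M)) rs≡ rs-in)
      1∈tableau : 1 ∈ rs ++ rs'
      1∈tableau = occ-pos⇒∈ (rs ++ rs') (≤-reflexive (sym (All.lookup (proj₂ syt-once)
                                                   (range-∈⁺ (s≤s z≤n , ≤-trans (proj₁ x-in) (proj₂ x-in))))))
      x≡1 : x ≡ 1
      x≡1 = tableau-corner (subst Sorted rs≡ (Linked⇒Sorted rs-inc)) (Linked⇒Sorted rs'-inc)
              (subst (λ xs → ColumnStrict xs rs') rs≡ columns) (proj₁ x-in)
              (subst (λ xs → 1 ∈ xs ++ rs') rs≡ 1∈tableau)

    bs-above-c₂ : All (unrank (suc M) <_) bs
    bs-above-c₂ = All-reverse⁺ (AllP.map⁺ (All.map (λ p-in → unrank-antitone (proj₁ p-in)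
                     (proj₂ ValidRank-M+1) (s≤s (proj₂ p-in))) rs'-in))

    Hall-rows-2-3 : Hall bs cs
    Hall-rows-2-3 = Hall-add-two bs (unrank (suc (suc M))) (unrank (suc M)) cs₀
      (Hall-reverse⁻ bs cs₀ (subst₂ Hall (sym (reverse-involutive (map unrank rs'))) (sym (reverse-involutive (map unrank rs)))
        (column-strict⇒Hall (map unrank rs') (map unrank rs)
          (map-antitone-Descending (All.map InRange⇒ValidRank rs'-in) (Linked⇒Sorted rs'-inc))
          (subst₂ _≤_ (sym (trans (length-map unrank rs') (Vecₚ.length-toList r')))
                      (sym (trans (length-map unrank rs) (Vecₚ.length-toList r))) st≤m)
          (map-antitone-ColumnStrict (All.map InRange⇒ValidRank rs-in) (All.map InRange⇒ValidRank rs'-in) columns))))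

    good : Good 3 3 s t n (toQueue (a , r , r'))
    good = Good-intro a _ _ _ _ (toList-reverse-map unrank r') (toList-reverse-map unrank r)
             a-inc bs-inc cs-inc exactlyOnce (last-row3 rs refl) Hall-rows-2-3 bs-above-c₂

    toTableau-toQueue : toTableau (toQueue (a , r , r')) ≡ (a , r , r')
    toTableau-toQueue = cong₂ (λ x y → a , x , y) (rank-unrank-row rs-in) (rank-unrank-row rs'-in)
      where
      rank-unrank-row : ∀ {k} {v : Vec ℕ k} → All (InRange M) (toList v) →
                        Vec.reverse (Vec.map rank (Vec.reverse (Vec.map unrank v))) ≡ v
      rank-unrank-row {v = v} v-in = reverse-map-reverse-map rank unrank v
        (All.map (λ p-in → let (1≤p , p≤) = InRange⇒ValidRank p-in in rank-unrank 1≤p p≤) v-in)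

  module ToTableau (a : Vec ℕ s) (b : Vec ℕ (s + t)) (c₁ c₂ : ℕ) (cr : Vec ℕ m)
    (good : Good 3 3 s t n (a , b , c₁ ∷ᵥ c₂ ∷ᵥ cr)) where

    as bs cs₀ cs : List ℕ
    as = toList a
    bs = toList b
    cs₀ = toList cr
    cs = c₁ ∷ c₂ ∷ cs₀

    a-inc : Linked _<_ as
    a-inc = proj₁ (proj₁ good)
    b-inc : Linked _<_ bs
    b-inc = proj₁ (proj₂ (proj₁ good))
    c-inc : Linked _<_ cs
    c-inc = proj₁ (proj₂ (proj₂ (proj₁ good)))
    once : ExactlyOnce N (as ++ bs ++ cs)
    once = proj₂ (proj₂ (proj₂ (proj₁ good)))

    last≡N : last cs ≡ just N
    last≡N = proj₁ (proj₂ good)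

    ω₁≡3 : labelOf (runPaths bs cs [] as) c₁ ≡ 3
    ω₁≡3 = ∷-injectiveˡ (proj₂ (proj₂ good))
    ω₂≡3 : labelOf (runPaths bs cs [] as) c₂ ≡ 3
    ω₂≡3 = ∷-injectiveˡ (∷-injectiveʳ (proj₂ (proj₂ good)))

    a-in : All (InRange N) as
    a-in = proj₁ (AllP.++⁻ as (proj₁ once))
    bc-in : All (InRange N) (bs ++ cs)
    bc-in = proj₂ (AllP.++⁻ as (proj₁ once))

    open Row1 a (Sorted⇒Unique (Linked⇒Sorted a-inc)) a-in

    occ≡1 : ∀ {k} → InRange N k → occ k (as ++ bs ++ cs) ≡ 1
    occ≡1 k-in = All.lookup (proj₂ once) (range-∈⁺ k-in)

    occ-++-≥2 : ∀ {k} X Y → k ∈ X → k ∈ Y → 2 ≤ occ k (X ++ Y)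
    occ-++-≥2 X Y k∈X k∈Y = subst (2 ≤_) (sym (count-++ (_≟ _) X Y))
                              (+-mono-≤ (count-pos (_≟ _) k∈X refl) (count-pos (_≟ _) k∈Y refl))

    ∉as : ∀ {x} → x ∈ bs ++ cs → x ∉ as
    ∉as x∈ x∈as = 1+n≰n (subst (2 ≤_) (occ≡1 (All.lookup bc-in x∈)) (occ-++-≥2 as (bs ++ cs) x∈as x∈))

    ∈desc : ∀ {x} → x ∈ bs ++ cs → x ∈ desc
    ∈desc x∈ = ∈-desc⁺ (All.lookup bc-in x∈) (∉as x∈)

    bs≢c₂ : All (_≢ c₂) bs
    bs≢c₂ = All.tabulate λ {x} x∈ x≡c₂ → 1+n≰n (subst (2 ≤_) (occ≡1 (All.lookup bc-in (∈-++⁺ˡ x∈)))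
      (≤-trans (occ-++-≥2 bs cs x∈ (subst (_∈ cs) (sym x≡c₂) (there (here refl))))
               (subst (occ x (bs ++ cs) ≤_) (sym (count-++ (_≟ x) as (bs ++ cs))) (m≤n+m _ _))))

    hall-and-above : Hall bs cs × All (c₂ <_) bs
    hall-and-above = two-smallest-unlabelled⇒Hall as bs c₁ c₂ cs₀ c-inc bs≢c₂ ω₁≡3 ω₂≡3
    bs-above-c₂ : All (c₂ <_) bs
    bs-above-c₂ = proj₂ hall-and-above

    c₁<c₂ : c₁ < c₂
    c₁<c₂ = Linked.head c-inc
    cs₀-Sorted : Sorted cs₀
    cs₀-Sorted = Linked⇒Sorted (Linked.tail (Linked.tail c-inc))
    cs₀-above-c₂ : All (c₂ <_) cs₀
    cs₀-above-c₂ with Linked⇒Sorted (Linked.tail c-inc)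
    ... | c₂<cs₀ ∷ _ = c₂<cs₀

    Hall-row3-tail : Hall bs cs₀
    Hall-row3-tail = Hall-drop-two-smallest bs c₁ c₂ cs₀ (Linked⇒Sorted c-inc) bs-above-c₂ (proj₁ hall-and-above)

    columns-reversed : length (reverse bs) ≤ length (reverse cs₀) × ColumnStrict (reverse bs) (reverse cs₀)
    columns-reversed = Hall⇒column-strict (reverse bs) (reverse cs₀)
      (AllPairs-reverse⁺ (Linked⇒Sorted b-inc)) (AllPairs-reverse⁺ cs₀-Sorted) (Hall-reverse⁺ bs cs₀ Hall-row3-tail)

    st≤m : s + t ≤ m
    st≤m = subst₂ _≤_ (trans (length-reverse bs) (Vecₚ.length-toList b)) (trans (length-reverse cs₀) (Vecₚ.length-toList cr))
             (proj₁ columns-reversed)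

    desc-shape : ∀ {d} → d ∈ desc → d ≡ c₁ ⊎ c₂ ≤ d
    desc-shape d∈ with ∈-desc⁻ d∈
    ... | d-in , d∉as with ∈-++⁻ as (occ-pos⇒∈ (as ++ bs ++ cs) (≤-reflexive (sym (occ≡1 d-in))))
    ...   | inj₁ d∈as = ⊥-elim (d∉as d∈as)
    ...   | inj₂ d∈bc with ∈-++⁻ bs d∈bc
    ...     | inj₁ d∈bs = inj₂ (<⇒≤ (All.lookup bs-above-c₂ d∈bs))
    ...     | inj₂ (here d≡c₁) = inj₁ d≡c₁
    ...     | inj₂ (there (here d≡c₂)) = inj₂ (≤-reflexive (sym d≡c₂))
    ...     | inj₂ (there (there d∈cs₀)) = inj₂ (<⇒≤ (All.lookup cs₀-above-c₂ d∈cs₀))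

    c₁∈desc : c₁ ∈ desc
    c₁∈desc = ∈desc (∈-++⁺ʳ bs (here refl))
    c₂∈desc : c₂ ∈ desc
    c₂∈desc = ∈desc (∈-++⁺ʳ bs (there (here refl)))

    rank-c₁ : rank c₁ ≡ suc (suc M)
    rank-c₁ = trans (count-all (c₁ ≤?_) (All.tabulate c₁≤)) length-desc≡
      where
      c₁≤ : ∀ {d} → d ∈ desc → c₁ ≤ d
      c₁≤ d∈ with desc-shape d∈
      ... | inj₁ d≡c₁ = ≤-reflexive (sym d≡c₁)
      ... | inj₂ c₂≤d = ≤-trans (<⇒≤ c₁<c₂) c₂≤d

    rank-c₂ : rank c₂ ≡ suc M
    rank-c₂ with ∈⇒removal c₁∈desc
    ... | desc' , r = trans (count-removal-no (c₂ ≤?_) r (<⇒≱ c₁<c₂))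
                        (trans (count-all (c₂ ≤?_) (All.tabulate c₂≤)) (suc-injective (trans (sym (removal-length r)) length-desc≡)))
      where
      c₂≤ : ∀ {d} → d ∈ desc' → c₂ ≤ d
      c₂≤ d∈ with desc-shape (removal-⊆ r d∈)
      ... | inj₂ c₂≤d = c₂≤d
      ... | inj₁ refl with removed-related r desc-Descending d∈
      ...   | inj₁ d<d = ⊥-elim (<-irrefl refl d<d)
      ...   | inj₂ d<d = ⊥-elim (<-irrefl refl d<d)

    bs-∈-desc : All (_∈ desc) bs
    bs-∈-desc = All.tabulate (∈desc ∘ ∈-++⁺ˡ)
    cs₀-∈-desc : All (_∈ desc) cs₀
    cs₀-∈-desc = All.tabulate (λ x∈ → ∈desc (∈-++⁺ʳ bs (there (there x∈))))

    rank-above-c₂ : ∀ {x} → x ∈ desc → c₂ < x → InRange M (rank x)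
    rank-above-c₂ x∈ c₂<x = rank-pos x∈ , s≤s⁻¹ (subst (rank _ <_) rank-c₂ (rank-antitone c₂∈desc x∈ c₂<x))

    open AntitoneMap rank (_∈ desc) rank-antitone

    rs rs' : List ℕ
    rs = reverse (map rank cs₀)
    rs' = reverse (map rank bs)

    ranks-in : ∀ {xs} → All (_∈ desc) xs → All (c₂ <_) xs → All (InRange M) (reverse (map rank xs))
    ranks-in xs-∈ xs>c₂ = All-reverse⁺ (AllP.map⁺ (All.zipWith (λ (x∈ , c₂<x) → rank-above-c₂ x∈ c₂<x) (xs-∈ , xs>c₂)))

    rs-in : All (InRange M) rs
    rs-in = ranks-in cs₀-∈-desc cs₀-above-c₂
    rs'-in : All (InRange M) rs'
    rs'-in = ranks-in bs-∈-desc bs-above-c₂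

    columns : ColumnStrict rs rs'
    columns = subst₂ ColumnStrict (reverse-map rank cs₀) (reverse-map rank bs)
      (map-antitone-ColumnStrict (All-reverse⁺ bs-∈-desc) (All-reverse⁺ cs₀-∈-desc) (proj₂ columns-reversed))

    occ-tableau : ∀ p → InRange M p → occ p (rs ++ rs') ≡ 1
    occ-tableau p (1≤p , p≤M) = begin
      occ p (rs ++ rs')
        ≡⟨ count-++ (_≟ p) rs rs' ⟩
      occ p rs + occ p rs'
        ≡⟨ cong₂ _+_ (count-reverse (_≟ p) (map rank cs₀)) (count-reverse (_≟ p) (map rank bs)) ⟩
      occ p (map rank cs₀) + occ p (map rank bs)
        ≡⟨ cong₂ _+_ (occ-ranks cs₀-∈-desc) (occ-ranks bs-∈-desc) ⟩
      occ (unrank p) cs₀ + occ (unrank p) bs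
        ≡⟨ +-comm (occ (unrank p) cs₀) _ ⟩
      occ (unrank p) bs + occ (unrank p) cs₀
        ≡⟨ sym (cong₂ (λ x y → x + (occ (unrank p) bs + y)) (occ-∉ as (proj₂ (∈-desc⁻ p∈))) occ-cs) ⟩
      occ (unrank p) as + (occ (unrank p) bs + occ (unrank p) cs)
        ≡⟨ sym (occ-++₃ (unrank p) as bs cs) ⟩
      occ (unrank p) (as ++ bs ++ cs)
        ≡⟨ occ≡1 (proj₁ (∈-desc⁻ p∈)) ⟩
      1 ∎
      where
      open ≡-Reasoning
      p≤length : p ≤ length desc
      p≤length = subst (p ≤_) (sym length-desc≡) (≤-trans p≤M (≤-trans (n≤1+n M) (n≤1+n (suc M))))
      p∈ : unrank p ∈ desc
      p∈ = unrank-∈ 1≤p p≤length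
      rank-p : rank (unrank p) ≡ p
      rank-p = rank-unrank 1≤p p≤length
      occ-ranks : ∀ {xs} → All (_∈ desc) xs → occ p (map rank xs) ≡ occ (unrank p) xs
      occ-ranks {xs} xs-∈ = trans (cong (λ z → occ z (map rank xs)) (sym rank-p))
                         (occ-map rank (unrank p) _ (λ y∈ eq → rank-injective (All.lookup xs-∈ y∈) p∈ eq))
      unrank-p≢ : ∀ {c} → M < rank c → c ≢ unrank p
      unrank-p≢ M<rank-c c≡ = <⇒≱ (subst (M <_) (trans (cong rank c≡) rank-p) M<rank-c) p≤M
      occ-cs : occ (unrank p) cs ≡ occ (unrank p) cs₀
      occ-cs = trans (count-removal-no (_≟ unrank p) {c₁} rhere (unrank-p≢ (subst (M <_) (sym rank-c₁) (m<n⇒m<1+n (n<1+n M)))))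
                     (count-removal-no (_≟ unrank p) {c₂} rhere (unrank-p≢ (subst (M <_) (sym rank-c₂) (n<1+n M))))

    a-in′ : All (InRange (N ∸ 1)) as
    a-in′ = All.tabulate λ x∈ → let (1≤x , x≤N) = All.lookup a-in x∈ in
      1≤x , s≤s⁻¹ (≤∧≢⇒< x≤N (λ x≡N → ∉as (∈-++⁺ʳ bs (last-∈ cs last≡N)) (subst (_∈ as) x≡N x∈)))

    rs≡ : toList (Vec.reverse (Vec.map rank cr)) ≡ rs
    rs≡ = toList-reverse-map rank cr
    rs'≡ : toList (Vec.reverse (Vec.map rank b)) ≡ rs'
    rs'≡ = toList-reverse-map rank b

    ∈-candidates : toTableau (a , b , c₁ ∷ᵥ c₂ ∷ᵥ cr) ∈ candidates
    ∈-candidates = ∈-pairs⁺ _,_ (allVecs-∈⁺ (N ∸ 1) a a-in′)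
      (∈-pairs⁺ _,_ (allVecs-∈⁺ M _ (subst (All (InRange M)) (sym rs≡) rs-in))
                    (allVecs-∈⁺ M _ (subst (All (InRange M)) (sym rs'≡) rs'-in)))

    admissible : Admissible (toTableau (a , b , c₁ ∷ᵥ c₂ ∷ᵥ cr))
    admissible = a-inc , st≤m ,
      subst (Linked _<_) (sym rs≡) (LinkedP.AllPairs⇒Linked (reverse-map-antitone-Sorted cs₀-∈-desc cs₀-Sorted)) ,
      subst (Linked _<_) (sym rs'≡) (LinkedP.AllPairs⇒Linked (reverse-map-antitone-Sorted bs-∈-desc (Linked⇒Sorted b-inc))) ,
      subst₂ ColumnStrict (sym rs≡) (sym rs'≡) columns ,
      subst₂ (λ X Y → ExactlyOnce M (X ++ Y)) (sym rs≡) (sym rs'≡)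
        (AllP.++⁺ rs-in rs'-in , All.tabulate (λ p∈ → occ-tableau _ (range-∈⁻ p∈)))

    toQueue-toTableau : toQueue (toTableau (a , b , c₁ ∷ᵥ c₂ ∷ᵥ cr)) ≡ (a , b , c₁ ∷ᵥ c₂ ∷ᵥ cr)
    toQueue-toTableau = cong₂ (λ x y → a , x , y) (unrank-rank-row bs-∈-desc)
      (cong₂ _∷ᵥ_ unrank-top (cong₂ _∷ᵥ_ unrank-next (unrank-rank-row cs₀-∈-desc)))
      where
      unrank-top : unrank (suc (suc M)) ≡ c₁
      unrank-top = trans (cong unrank (sym rank-c₁)) (unrank-rank c₁∈desc)
      unrank-next : unrank (suc M) ≡ c₂
      unrank-next = trans (cong unrank (sym rank-c₂)) (unrank-rank c₂∈desc)
      unrank-rank-row : ∀ {k} {v : Vec ℕ k} → All (_∈ desc) (toList v) →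
                        Vec.reverse (Vec.map unrank (Vec.reverse (Vec.map rank v))) ≡ v
      unrank-rank-row {v = v} v-∈ = reverse-map-reverse-map unrank rank v (All.map unrank-rank v-∈)

  CMLQ-∈-allTriples : ∀ (q : Triple s t n) → IsCMLQ s t n q → q ∈ allTriples s t n
  CMLQ-∈-allTriples (a , b , c) (_ , _ , _ , in-range , _) with AllP.++⁻ (toList a) in-range
  ... | a-in , bc-in = allTriples-∈⁺ s t n a b c (allVecs-∈⁺ N a a-in)
                         (allVecs-∈⁺ N b (proj₁ (AllP.++⁻ (toList b) bc-in)))
                         (allVecs-∈⁺ N c (proj₂ (AllP.++⁻ (toList b) bc-in)))

  count-admissible≡nxy : count admissible? candidates ≡ nxy 3 3 s t n
  count-admissible≡nxy =
    count-bijection admissible? (good? 3 3 s t n) candidates (allTriples s t n)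
      (Unique-pairs⁺ _,_ proj₁ proj₂ (λ _ _ → refl) (λ _ _ → refl) (allVecs-Unique (N ∸ 1) s)
         (Unique-pairs⁺ _,_ proj₁ proj₂ (λ _ _ → refl) (λ _ _ → refl) (allVecs-Unique M m) (allVecs-Unique M (s + t))))
      (allTriples-Unique s t n) toQueue toTableau to-queue to-tableau
    where
    to-queue : ∀ {x} → x ∈ candidates → Admissible x →
               toQueue x ∈ allTriples s t n × Good 3 3 s t n (toQueue x) × toTableau (toQueue x) ≡ x
    to-queue x∈ (a-inc , syt) with ∈-pairs⁻ _,_ {xs = allVecs (N ∸ 1) s} x∈
    ... | a , T , a∈ , T∈ , refl with ∈-pairs⁻ _,_ {xs = allVecs M m} T∈
    ...   | r , r' , _ , _ , refl = CMLQ-∈-allTriples _ (proj₁ Q.good) , Q.good , Q.toTableau-toQueue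
      where module Q = ToQueue a r r' (allVecs-∈⁻ (N ∸ 1) a a∈) a-inc syt
    to-tableau : ∀ {q} → q ∈ allTriples s t n → Good 3 3 s t n q →
                 toTableau q ∈ candidates × Admissible (toTableau q) × toQueue (toTableau q) ≡ q
    to-tableau {a , b , c₁ ∷ᵥ c₂ ∷ᵥ cr} _ good = T.∈-candidates , T.admissible , T.toQueue-toTableau
      where module T = ToTableau a b c₁ c₂ cr good

lemma4p1 : (n s t : ℕ) → 2 ≤ n → s + t ≤ n →
    nxy 3 3 s t n ≡ ((bigN s t n ∸ 1) C s) * f (n ∸ 2) (s + t)
lemma4p1 (suc zero) _ _ (s≤s ()) _
lemma4p1 (suc (suc m)) s t _ _ = begin
  nxy 3 3 s t (suc (suc m))
    ≡⟨ sym count-admissible≡nxy ⟩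
  count admissible? candidates
    ≡⟨ count-pairs increasing? (isSYT? m (s + t)) (allVecs (N ∸ 1) s) tableaux ⟩
  count increasing? (allVecs (N ∸ 1) s) * f m (s + t)
    ≡⟨ cong (_* f m (s + t)) (count-increasing-allVecs (N ∸ 1) s) ⟩
  ((N ∸ 1) C s) * f m (s + t) ∎
  where
  open ≡-Reasoning
  open QueueTableauBijection s t m
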